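{- Let $\Gamma$ be a finite simple undirected graph with spanning tree $T$, base vertex $v_0$, cotree edges $e_1,\dots,e_t$ with chosen arcs $h(e_i)=(u_i,v_i)$, and basic closed walks $L_1,\dots,L_t$ as described in the context. Let $p$ be a prime and $A=\prod_{\eta=1}^{a}\mathbb{Z}/p^{k_{\eta}}$ with $k_{1}\leqslant\cdots\leqslant k_{a}=k$, and let $\phi$ be a $T$-reduced $A$-voltage assignment on $\Gamma$. Let $\alpha\in Aut(\Gamma)$, let $S^{\alpha}\in GL(t,\mathbb{Z})$ be its matrix on $H_1(\Gamma;\mathbb{Z})$ with respect to $L_1,\dots,L_t$, and let $B\in\mathcal{M}_{t\times a}(R)$, $R=\mathbb{Z}/p^{k}$, be the matrix defined in the context. Suppose $Q\in GL(t,R)$ and $T'\in GL(a,R)$ are such that $B^{0}=QBT'$ is in normal form, $(B^{0})_{i,j}=\delta_{i,j}p^{s_{i}}$ with $0\leqslant s_1\leqslant\cdots\leqslant s_t\leqslant k$, and let $i_{0}$ be the smallest $i$ with $s_{i}>0$. Then $\alpha$ can be lifted to an automorphism of the derived graph $\Gamma\times_{\phi}A$ if and only if $$d_{p}\big((QS^{\alpha}Q^{ -1})_{i,j}\big)\geqslant s_{i}-s_{j}\quad\text{for all } i>j,$$ where $S^{\alpha}$ is regarded as a matrix over $R$ by reducing its entries mod $p^k$.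
   Context: Graphs are finite, simple and undirected; each edge $\{u,v\}$ gives two opposite arcs $(u,v),(v,u)$. Abelian groups are written additively. An $A$-voltage assignment is a function $\phi$ from arcs to $A$ with $\phi(v,u)=-\phi(u,v)$; it extends to walks by summing the voltages of the traversed arcs. The derived graph $\Gamma\times_{\phi}A$ has vertex set $V(\Gamma)\times A$ and edges $\{(u,g),(v,\phi(u,v)+g)\}$ for $\{u,v\}\in E(\Gamma)$, $g\in A$; $\pi$ is the projection to the first coordinate. An automorphism $\alpha$ of $\Gamma$ lifts if there is an automorphism $\tilde\alpha$ of $\Gamma\times_\phi A$ with $\pi\tilde\alpha=\alpha\pi$. Given a spanning tree $T$ of $\Gamma$ (the edges not in $T$ are cotree edges), $\phi$ is $T$-reduced if every arc of a tree edge has voltage $0$. Fix a vertex $v_0$; for vertices $x,y$ let $W(x,y)$ be the unique reduced walk in $T$ from $x$ to $y$. For each cotree edge $e_i$ ($1\le i\le t$) one arc $h(e_i)=(u_i,v_i)$ is chosen, and $L_i=W(v_0,u_i)\,h(e_i)\,W(v_i,v_0)$. The classes of $L_1,\dots,L_t$ form a basis of $H_1(\Gamma;\mathbb{Z})\cong\mathbb{Z}^t$; $\alpha$ induces $\alpha_*$ on $H_1(\Gamma;\mathbb{Z})$ and $S^\alpha$ is defined by $\alpha_*(L_i)=\sum_{j=1}^t (S^\alpha)_{i,j}L_j$. Write $\theta_i=\phi(L_i)=(\theta_i(1),\dots,\theta_i(a))$ with $\theta_i(\eta)\in\mathbb{Z}/p^{k_\eta}$, and define $B_{i,j}=p^{k-k_j}\theta_i(j)\in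 R$ (the image of $\theta_i(j)$ under the injection $\mathbb{Z}/p^{k_j}\hookrightarrow\mathbb{Z}/p^{k}$, $\lambda\mapsto p^{k-k_j}\lambda$). For $0\neq\lambda\in R$, the $p$-degree $d_p(\lambda)$ is the largest $r$ with $0\le r<k$ and $p^r\mid\lambda$; by convention $d_p(0)=k$. A nonzero matrix $Y\in\mathcal{M}_{m\times n}(R)$ is in normal form if $Y_{i,j}=\delta_{i,j}p^{r_i}$ with $0\le r_1\le\cdots\le r_l<k=r_{l+1}=\cdots=r_m$ for some $l\le\min\{m,n\}$. -}

module Defs where

open import Data.Nat as ℕ using (ℕ; zero; suc; _^_; _∸_; _≤_; _<_)
import Data.Nat.Divisibility as ℕD
open import Data.Nat.DivMod using (_mod_)
open import Data.Integer as ℤ using (ℤ; +_; _-_)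
open import Data.Integer.Divisibility using (_∣_)
open import Data.Fin using (Fin; toℕ; _≟_)
import Data.Fin as F
open import Data.Unit using (⊤; tt)
open import Data.Empty using (⊥)
open import Data.Product using (Σ; ∃; _×_; _,_; proj₁; proj₂)
open import Data.Sum using (_⊎_)
open import Function using (_∘_)
open import Relation.Nullary using (¬_; yes; no)
open import Relation.Binary.PropositionalEquality using (_≡_)

_⇔_ : Set → Set → Set
P ⇔ Q = (P → Q) × (Q → P)

record Graph (n : ℕ) : Set₁ where
  field
    Adj     : Fin n → Fin n → Set
    sym     : ∀ {x y} → Adj x y → Adj y x
    irrefl  : ∀ {x} → ¬ Adj x x

data Walk {n : ℕ} (R : Fin n → Fin n → Set) : Fin n → Fin n → Set where
  nil  : ∀ x → Walk R x x
  cons : ∀ {x y z} → R x y → Walk R y z → Walk R x z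

_++_ : ∀ {n} {R : Fin n → Fin n → Set} {x y z} → Walk R x y → Walk R y z → Walk R x z
nil _    ++ w' = w'
cons r w ++ w' = cons r (w ++ w')

mapW : ∀ {n} {R R' : Fin n → Fin n → Set} (g : Fin n → Fin n) →
       (∀ {x y} → R x y → R' (g x) (g y)) → ∀ {x y} → Walk R x y → Walk R' (g x) (g y)
mapW g f (nil x)    = nil (g x)
mapW g f (cons r w) = cons (f r) (mapW g f w)

Reduced : ∀ {n} {R : Fin n → Fin n → Set} {x y} → Walk R x y → Set
Reduced (nil _)                              = ⊤
Reduced (cons r (nil _))                     = ⊤
Reduced (cons {x} r (cons {y = z} r' w)) = ¬ (x ≡ z) × Reduced (cons r' w)

IsNil : ∀ {n} {R : Fin n → Fin n → Set} {x y} → Walk R x y → Set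
IsNil (nil _)    = ⊤
IsNil (cons _ _) = ⊥

record SpanningTree {n : ℕ} (Γ : Graph n) : Set₁ where
  open Graph Γ
  field
    TAdj      : Fin n → Fin n → Set
    sub       : ∀ {x y} → TAdj x y → Adj x y
    Tsym      : ∀ {x y} → TAdj x y → TAdj y x
    connected : ∀ x y → Walk TAdj x y
    acyclic   : ∀ x (w : Walk TAdj x x) → Reduced w → IsNil w

-- W(x,y): the reduced walk in T from x to y (unique since T is a tree)
record TreeWalks {n : ℕ} {Γ : Graph n} (T : SpanningTree Γ) : Set₁ where
  open SpanningTree T
  field
    W         : ∀ x y → Walk TAdj x y
    W-reduced : ∀ x y → Reduced (W x y)

record Cotree {n : ℕ} {Γ : Graph n} (T : SpanningTree Γ) (t : ℕ) : Set where
  open Graph Γ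
  open SpanningTree T
  field
    u v    : Fin t → Fin n
    adj    : ∀ i → Adj (u i) (v i)
    notT   : ∀ i → ¬ TAdj (u i) (v i)
    cover  : ∀ x y → Adj x y → ¬ TAdj x y →
             ∃ λ i → (u i ≡ x × v i ≡ y) ⊎ (u i ≡ y × v i ≡ x)
    inj    : ∀ i j → (u i ≡ u j × v i ≡ v j) ⊎ (u i ≡ v j × v i ≡ u j) → i ≡ j

L : ∀ {n t} {Γ : Graph n} {T : SpanningTree Γ} → TreeWalks T → Cotree T t →
    (v0 : Fin n) → Fin t → Walk (Graph.Adj Γ) v0 v0
L {T = T} Wk C v0 i =
  mapW (λ x → x) (SpanningTree.sub T) (TreeWalks.W Wk v0 (Cotree.u C i))
  ++ cons (Cotree.adj C i) (mapW (λ x → x) (SpanningTree.sub T) (TreeWalks.W Wk (Cotree.v C i) v0))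

record Aut {n : ℕ} (Γ : Graph n) : Set where
  open Graph Γ
  field
    α      : Fin n → Fin n
    α⁻¹    : Fin n → Fin n
    inv₁   : ∀ x → α (α⁻¹ x) ≡ x
    inv₂   : ∀ x → α⁻¹ (α x) ≡ x
    pres   : ∀ {x y} → Adj x y → Adj (α x) (α y)
    refl'  : ∀ {x y} → Adj (α x) (α y) → Adj x y

Σℤ : ∀ n → (Fin n → ℤ) → ℤ
Σℤ zero    f = + 0
Σℤ (suc n) f = f F.zero ℤ.+ Σℤ n (f ∘ F.suc)

Mat : ℕ → ℕ → Set
Mat m n = Fin m → Fin n → ℤ

_·_ : ∀ {m n r} → Mat m n → Mat n r → Mat m r
_·_ {n = n} X Y i j = Σℤ n (λ l → X i l ℤ.* Y l j)

δ : ∀ {m n} → Fin m → Fin n → ℤ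
δ i j with toℕ i ℕ.≟ toℕ j
... | yes _ = + 1
... | no _  = + 0

infix 4 _≡[_]_
_≡[_]_ : ℤ → ℕ → ℤ → Set
x ≡[ m ] y = (+ m) ∣ (x - y)

-- Q, Q⁻¹ are mutually inverse modulo m (so Q ∈ GL(t, ℤ/m) with inverse Q⁻¹)
InverseMod : ℕ → ∀ {t} → Mat t t → Mat t t → Set
InverseMod m Q Qi = (∀ i j → (Q · Qi) i j ≡[ m ] δ i j) × (∀ i j → (Qi · Q) i j ≡[ m ] δ i j)

-- p-degree in R = ℤ/p^k of the class of λ:
-- largest r ≤ k with p^r ∣ λ (this is k iff λ ≡ 0 mod p^k)
dp : ℕ → ℕ → ℤ → ℕ
dp p k c = go k
  where
  go : ℕ → ℕ
  go zero    = 0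
  go (suc r) with (p ^ suc r) ℕD.∣? ℤ.∣ c ∣
  ... | yes _ = suc r
  ... | no _  = go r

IsNormalForm : (p k : ℕ) → ∀ {m n} → Mat m n → (Fin m → ℕ) → Set
IsNormalForm p k {m} {n} Y s =
  (∃ λ i → ∃ λ j → ¬ (Y i j ≡[ p ^ k ] + 0)) ×
  (∃ λ l → l ≤ m × l ≤ n ×
     (∀ i → toℕ i < l → s i < k) ×
     (∀ i → l ≤ toℕ i → s i ≡ k)) ×
  (∀ i j → toℕ i ≤ toℕ j → s i ≤ s j) ×
  (∀ i j → Y i j ≡[ p ^ k ] (δ i j ℤ.* + (p ^ s i)))

-- The group A = ∏_{η} ℤ/M_η, elements as tuples of canonical residues

Elt : (a : ℕ) → (Fin a → ℕ) → Set
Elt zero    M = ⊤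
Elt (suc a) M = Fin (M F.zero) × Elt a (M ∘ F.suc)

comp : ∀ {a M} → Elt a M → (j : Fin a) → Fin (M j)
comp {suc a} (x , _) F.zero    = x
comp {suc a} (_ , g) (F.suc j) = comp g j

addM : ∀ {m} → Fin m → Fin m → Fin m
addM {suc m} x y = (toℕ x ℕ.+ toℕ y) mod suc m

negM : ∀ {m} → Fin m → Fin m
negM {suc m} x = (suc m ∸ toℕ x) mod suc m

addE : ∀ {a M} → Elt a M → Elt a M → Elt a M
addE {zero}  _ _ = tt
addE {suc a} (x , g) (y , h) = addM x y , addE g h

negE : ∀ {a M} → Elt a M → Elt a M
negE {zero}  _ = tt
negE {suc a} (x , g) = negM x , negE g

IsZeroE : ∀ {a M} → Elt a M → Set
IsZeroE {a} g = ∀ j → toℕ (comp g j) ≡ 0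

-- A-voltage assignment (values on non-adjacent pairs are irrelevant)
record Voltage {n : ℕ} (Γ : Graph n) (a : ℕ) (M : Fin a → ℕ) : Set where
  open Graph Γ
  field
    φ    : Fin n → Fin n → Elt a M
    anti : ∀ {x y} → Adj x y → φ y x ≡ negE (φ x y)

TReduced : ∀ {n a M} {Γ : Graph n} → SpanningTree Γ → Voltage Γ a M → Set
TReduced {n} T V = ∀ {x y : Fin n} → SpanningTree.TAdj T x y → IsZeroE (Voltage.φ V x y)

-- integer representative of the j-th coordinate of φ(w) for a walk w
volℤ : ∀ {n a M} {Γ : Graph n} → Voltage Γ a M → ∀ {x y} → Walk (Graph.Adj Γ) x y → Fin a → ℤ
volℤ V (nil _) j = + 0
volℤ V (cons {x} {y} _ w) j = + toℕ (comp (Voltage.φ V x y) j) ℤ.+ volℤ V w j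

-- signed number of traversals of the arc (a , b) by a walk; the family
-- (cnt w a b) is the class of a closed walk w in H_1(Γ;ℤ) = cycle space ⊆ ℤ^E
cnt : ∀ {n} {R : Fin n → Fin n → Set} {x y} → Walk R x y → Fin n → Fin n → ℤ
cnt (nil _) a b = + 0
cnt (cons {x} {y} _ w) a b = ind x y ℤ.- ind y x ℤ.+ cnt w a b
  where
  ind : Fin _ → Fin _ → ℤ
  ind c d with c ≟ a | d ≟ b
  ... | yes _ | yes _ = + 1
  ... | _     | _     = + 0

DAdj : ∀ {n a M} {Γ : Graph n} → Voltage Γ a M →
       Fin n × Elt a M → Fin n × Elt a M → Set
DAdj {Γ = Γ} V (x , g) (y , h) = Graph.Adj Γ x y × (h ≡ addE (Voltage.φ V x y) g)

Lifts : ∀ {n a M} {Γ : Graph n} → Voltage Γ a M → Aut Γ → Set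
Lifts {n} {a} {M} V Al =
  Σ (Fin n × Elt a M → Fin n × Elt a M) λ F →
  Σ (Fin n × Elt a M → Fin n × Elt a M) λ G →
    (∀ z → F (G z) ≡ z) × (∀ z → G (F z) ≡ z) ×
    (∀ z z' → DAdj V z z' ⇔ DAdj V (F z) (F z')) ×
    (∀ z → proj₁ (F z) ≡ Aut.α Al (proj₁ z))

IsSα : ∀ {n t} {Γ : Graph n} {T : SpanningTree Γ} → TreeWalks T → Cotree T t →
       (v0 : Fin n) → Aut Γ → Mat t t → Set
IsSα {n} {t} {Γ} Wk C v0 Al S =
  ∀ i (x y : Fin n) →
    cnt (mapW {R' = Graph.Adj Γ} (Aut.α Al) (Aut.pres Al) (L Wk C v0 i)) x y
      ≡ Σℤ t (λ j → S i j ℤ.* cnt (L Wk C v0 j) x y)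

Bmat : ∀ {n t a M} {Γ : Graph n} {T : SpanningTree Γ} → TreeWalks T → Cotree T t →
       (v0 : Fin n) → Voltage Γ a M → (p k : ℕ) → (ks : Fin a → ℕ) → Mat t a
Bmat Wk C v0 V p k ks i j = + (p ^ (k ∸ ks j)) ℤ.* volℤ V (L Wk C v0 i) j

-- Closed walks are recorded by their coordinates c ∈ ℤᵗ with respect to L₁ … Lₜ
-- (the signed number of traversals of each chosen cotree arc); φ induces
-- φ₊ c = Σ cᵢ θᵢ on coordinates, and α acts on them by c ↦ c S.  A lift of α
-- carries closed walks of voltage 0 to closed walks of voltage 0, so S preserves
-- ker φ₊.  Conversely, if it does, c ↦ c S induces an automorphism f of im φ₊
-- (inverted by a power of S, as α has finite order), and
-- (x , g) ↦ (α x , f (g - r g) + r g + ρ x) is a lift, where r picks a canonical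
-- representative of each coset of im φ₊ and ρ x is the voltage of α applied to
-- the tree path from v₀ to x.  Finally ker φ₊ is the kernel of B over ℤ/p^k, which
-- Q carries to the kernel {y : p^{k - sᵢ} ∣ yᵢ} of diag(p^{s₁}, …, p^{sₜ}); and
-- Q S Q⁻¹ preserves that kernel exactly when p^{sᵢ - sⱼ} divides its (i , j)
-- entry for j < i, the entries with j > i being unconstrained because s is monotone.

module Submission where

open import Defs
open import Data.Nat using (ℕ; suc; _^_; _∸_; _≤_; _<_)
open import Data.Nat.Primality using (Prime)
open import Data.Fin using (Fin; toℕ; fromℕ)
open import Relation.Binary.PropositionalEquality using (_≡_)

open import Data.Nat as ℕ using (zero; z≤n; s≤s; NonZero)
import Data.Nat.Properties as ℕP
open import Data.Nat.Primality using (prime⇒nonZero)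
import Data.Nat.Divisibility as ℕD
open import Data.Nat.DivMod using (_mod_; _%_; _/_; m≡m%n+[m/n]*n; m%n<n)
open import Data.Integer as ℤ using (ℤ; +_; -[1+_]; -_; _+_; _*_; _-_)
import Data.Integer.Properties as ℤP
import Data.Integer.DivMod as ℤDM
import Data.Integer.Divisibility.Signed as ℤS
open import Data.Integer.Tactic.RingSolver using (solve-∀; solve)
import Data.Fin as F
import Data.Fin.Properties as FP
open import Data.Bool using (Bool; true; false; if_then_else_)
open import Data.Maybe as Maybe using (Maybe; just; nothing)
open import Data.Product using (Σ; ∃; _×_; _,_; proj₁; proj₂)
open import Data.Sum using (_⊎_; inj₁; inj₂)
open import Data.Unit using (tt)
open import Data.Empty using (⊥-elim)
open import Data.List as List using (List; _∷_; [])
open import Data.List.Membership.Propositional.Properties using (∈-tabulate⁺)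
import Data.List.Relation.Unary.All.Properties as AllP
open import Data.Nat.ListAction using (product)
open import Data.Nat.ListAction.Properties using (∈⇒∣product; product≢0)
open import Function using (_∘_)
open import Relation.Binary.PropositionalEquality
  using (refl; sym; trans; cong; cong₂; subst; module ≡-Reasoning)
open import Relation.Nullary using (¬_; Dec; yes; no; does)
open import Relation.Nullary.Decidable using (_×-dec_; decidable-stable; dec-true)

infix 4 _≡_[mod_]
record _≡_[mod_] (x y : ℤ) (m : ℕ) : Set where
  constructor by
  field
    quotient : ℤ
    equation : x ≡ y + quotient * + m

mod-refl : ∀ {m} x → x ≡ x [mod m ]
mod-refl {m} x = by (+ 0) (sym (trans (cong (λ e → x + e) (ℤP.*-zeroˡ (+ m))) (ℤP.+-identityʳ x)))

mod-reflexive : ∀ {m x y} → x ≡ y → x ≡ y [mod m ]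
mod-reflexive {x = x} refl = mod-refl x

mod-sym : ∀ {m x y} → x ≡ y [mod m ] → y ≡ x [mod m ]
mod-sym {m} {x} {y} (by q refl) = by (- q) (regroup y q (+ m))
  where
  regroup : ∀ y q m → y ≡ y + q * m + - q * m
  regroup = solve-∀

mod-trans : ∀ {m x y z} → x ≡ y [mod m ] → y ≡ z [mod m ] → x ≡ z [mod m ]
mod-trans {m} {z = z} (by q refl) (by r refl) = by (r + q) (regroup z r q (+ m))
  where
  regroup : ∀ z r q m → z + r * m + q * m ≡ z + (r + q) * m
  regroup = solve-∀

mod-+ : ∀ {m x y x' y'} → x ≡ x' [mod m ] → y ≡ y' [mod m ] → x + y ≡ x' + y' [mod m ]
mod-+ {m} {x' = x'} {y' = y'} (by q refl) (by r refl) = by (q + r) (regroup x' y' q r (+ m))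
  where
  regroup : ∀ x y q r m → x + q * m + (y + r * m) ≡ x + y + (q + r) * m
  regroup = solve-∀

mod-neg : ∀ {m x y} → x ≡ y [mod m ] → - x ≡ - y [mod m ]
mod-neg {m} {y = y} (by q refl) = by (- q) (regroup y q (+ m))
  where
  regroup : ∀ y q m → - (y + q * m) ≡ - y + - q * m
  regroup = solve-∀

mod-* : ∀ {m x y x' y'} → x ≡ x' [mod m ] → y ≡ y' [mod m ] → x * y ≡ x' * y' [mod m ]
mod-* {m} {x' = x'} {y' = y'} (by q refl) (by r refl) =
  by (q * y' + x' * r + q * r * + m) (regroup x' y' q r (+ m))
  where
  regroup : ∀ x y q r m → (x + q * m) * (y + r * m) ≡ x * y + (q * y + x * r + q * r * m) * m
  regroup = solve-∀

mod-*ˡ : ∀ {m y y'} c → y ≡ y' [mod m ] → c * y ≡ c * y' [mod m ]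
mod-*ˡ c = mod-* (mod-refl c)

mod-*ʳ : ∀ {m x x'} c → x ≡ x' [mod m ] → x * c ≡ x' * c [mod m ]
mod-*ʳ c e = mod-* e (mod-refl c)

multiple≡0 : ∀ {m} q → q * + m ≡ + 0 [mod m ]
multiple≡0 q = by q (sym (ℤP.+-identityˡ _))

mod-weaken : ∀ {m} d → ∀ {x y} → x ≡ y [mod d ℕ.* m ] → x ≡ y [mod m ]
mod-weaken {m} d {y = y} (by q refl) = by (q * + d) (cong (λ e → y + e) (begin
  q * + (d ℕ.* m)   ≡⟨ cong (q *_) (ℤP.pos-* d m) ⟩
  q * (+ d * + m)   ≡⟨ ℤP.*-assoc q (+ d) (+ m) ⟨
  q * + d * + m     ∎))
  where open ≡-Reasoning

mod-scale : ∀ {m x y} d → x ≡ y [mod m ] → + d * x ≡ + d * y [mod d ℕ.* m ]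
mod-scale {m} {y = y} d (by q refl) = by q (begin
  + d * (y + q * + m)       ≡⟨ regroup (+ d) y q (+ m) ⟩
  + d * y + q * (+ d * + m) ≡⟨ cong (λ e → + d * y + q * e) (ℤP.pos-* d m) ⟨
  + d * y + q * + (d ℕ.* m) ∎)
  where
  open ≡-Reasoning
  regroup : ∀ d y q m → d * (y + q * m) ≡ d * y + q * (d * m)
  regroup = solve-∀

mod-cancel : ∀ {m x} d → + suc d * x ≡ + 0 [mod suc d ℕ.* m ] → x ≡ + 0 [mod m ]
mod-cancel {m} {x} d (by q e) = by q (ℤP.*-cancelˡ-≡ (+ suc d) x (+ 0 + q * + m) (begin
  + suc d * x                  ≡⟨ e ⟩
  + 0 + q * + (suc d ℕ.* m)    ≡⟨ cong (λ e → + 0 + q * e) (ℤP.pos-* (suc d) m) ⟩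
  + 0 + q * (+ suc d * + m)    ≡⟨ regroup q (+ suc d) (+ m) ⟩
  + suc d * (+ 0 + q * + m)    ∎))
  where
  open ≡-Reasoning
  regroup : ∀ q d m → + 0 + q * (d * m) ≡ d * (+ 0 + q * m)
  regroup = solve-∀

≡[]⇒≡mod : ∀ {m x y} → x ≡[ m ] y → x ≡ y [mod m ]
≡[]⇒≡mod {m} {x} {y} d with ℤS.∣ᵤ⇒∣ d
... | ℤS.divides q e = by q (trans (regroup x y) (cong (λ e → y + e) e))
  where
  regroup : ∀ x y → x ≡ y + (x - y)
  regroup = solve-∀

≡mod0⇒∣ : ∀ {m x} → x ≡ + 0 [mod m ] → m ℕD.∣ ℤ.∣ x ∣
≡mod0⇒∣ {m} (by q refl) =
  ℕD.divides ℤ.∣ q ∣ (trans (cong ℤ.∣_∣ (ℤP.+-identityˡ (q * + m))) (ℤP.abs-* q (+ m)))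

∣⇒≡mod0 : ∀ {m x} → m ℕD.∣ ℤ.∣ x ∣ → x ≡ + 0 [mod m ]
∣⇒≡mod0 {m} {x} d with ℤS.∣ᵤ⇒∣ {+ m} {x} d
... | ℤS.divides q e = by q (trans e (sym (ℤP.+-identityˡ (q * + m))))

Σ-cong : ∀ n {f g : Fin n → ℤ} → (∀ i → f i ≡ g i) → Σℤ n f ≡ Σℤ n g
Σ-cong zero    e = refl
Σ-cong (suc n) e = cong₂ _+_ (e F.zero) (Σ-cong n (e ∘ F.suc))

Σ-+ : ∀ n (f g : Fin n → ℤ) → Σℤ n (λ i → f i + g i) ≡ Σℤ n f + Σℤ n g
Σ-+ zero    f g = refl
Σ-+ (suc n) f g rewrite Σ-+ n (f ∘ F.suc) (g ∘ F.suc) =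
  regroup (f F.zero) (g F.zero) (Σℤ n (f ∘ F.suc)) (Σℤ n (g ∘ F.suc))
  where
  regroup : ∀ a b c d → a + b + (c + d) ≡ a + c + (b + d)
  regroup = solve-∀

Σ-*ˡ : ∀ n c (f : Fin n → ℤ) → Σℤ n (λ i → c * f i) ≡ c * Σℤ n f
Σ-*ˡ zero    c f = sym (ℤP.*-zeroʳ c)
Σ-*ˡ (suc n) c f rewrite Σ-*ˡ n c (f ∘ F.suc) = sym (ℤP.*-distribˡ-+ c (f F.zero) _)

Σ-*ʳ : ∀ n c (f : Fin n → ℤ) → Σℤ n (λ i → f i * c) ≡ Σℤ n f * c
Σ-*ʳ n c f = trans (Σ-cong n (λ i → ℤP.*-comm (f i) c)) (trans (Σ-*ˡ n c f) (ℤP.*-comm c _))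

Σ-neg : ∀ n (f : Fin n → ℤ) → Σℤ n (λ i → - f i) ≡ - Σℤ n f
Σ-neg zero    f = refl
Σ-neg (suc n) f rewrite Σ-neg n (f ∘ F.suc) = sym (ℤP.neg-distrib-+ (f F.zero) _)

Σ-0 : ∀ n (f : Fin n → ℤ) → (∀ i → f i ≡ + 0) → Σℤ n f ≡ + 0
Σ-0 zero    f e = refl
Σ-0 (suc n) f e rewrite e F.zero | Σ-0 n (f ∘ F.suc) (e ∘ F.suc) = refl

Σ-swap : ∀ n m (f : Fin n → Fin m → ℤ) →
         Σℤ n (λ i → Σℤ m (f i)) ≡ Σℤ m (λ j → Σℤ n (λ i → f i j))
Σ-swap zero    m f = sym (Σ-0 m _ (λ _ → refl))
Σ-swap (suc n) m f rewrite Σ-swap n m (f ∘ F.suc) =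
  sym (Σ-+ m (f F.zero) (λ j → Σℤ n (λ i → f (F.suc i) j)))

Σ-mod : ∀ n {m} {f g : Fin n → ℤ} → (∀ i → f i ≡ g i [mod m ]) → Σℤ n f ≡ Σℤ n g [mod m ]
Σ-mod zero    e = mod-refl (+ 0)
Σ-mod (suc n) e = mod-+ (e F.zero) (Σ-mod n (e ∘ F.suc))

Σ-single : ∀ n (f : Fin n → ℤ) (l : Fin n) → (∀ i → ¬ i ≡ l → f i ≡ + 0) → Σℤ n f ≡ f l
Σ-single (suc n) f F.zero e =
  trans (cong (λ s → f F.zero + s) (Σ-0 n (f ∘ F.suc) (λ i → e (F.suc i) (λ ()))))
        (ℤP.+-identityʳ _)
Σ-single (suc n) f (F.suc l) e =
  trans (cong (_+ Σℤ n (f ∘ F.suc)) (e F.zero (λ ())))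
        (trans (ℤP.+-identityˡ _)
               (Σ-single n (f ∘ F.suc) l (λ i i≢l → e (F.suc i) (i≢l ∘ FP.suc-injective))))

δ-≡ : ∀ {m n} (i : Fin m) (j : Fin n) → toℕ i ≡ toℕ j → δ i j ≡ + 1
δ-≡ i j e with toℕ i ℕ.≟ toℕ j
... | yes _ = refl
... | no ne = ⊥-elim (ne e)

δ-≢ : ∀ {m n} (i : Fin m) (j : Fin n) → ¬ toℕ i ≡ toℕ j → δ i j ≡ + 0
δ-≢ i j ne with toℕ i ℕ.≟ toℕ j
... | yes e = ⊥-elim (ne e)
... | no _  = refl

δ-refl : ∀ {n} (i : Fin n) → δ i i ≡ + 1
δ-refl i = δ-≡ i i refl

δ-distinct : ∀ {n} (i j : Fin n) → ¬ i ≡ j → δ i j ≡ + 0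
δ-distinct i j ne = δ-≢ i j (ne ∘ FP.toℕ-injective)

Σ-δˡ : ∀ n (l : Fin n) (f : Fin n → ℤ) → Σℤ n (λ i → δ l i * f i) ≡ f l
Σ-δˡ n l f =
  trans (Σ-single n _ l (λ i i≢l → trans (cong (_* f i) (δ-distinct l i (i≢l ∘ sym))) (ℤP.*-zeroˡ (f i))))
        (trans (cong (_* f l) (δ-refl l)) (ℤP.*-identityˡ (f l)))

Σ-δʳ : ∀ n (l : Fin n) (f : Fin n → ℤ) → Σℤ n (λ i → f i * δ i l) ≡ f l
Σ-δʳ n l f =
  trans (Σ-single n _ l (λ i i≢l → trans (cong (f i *_) (δ-distinct i l i≢l)) (ℤP.*-zeroʳ (f i))))
        (trans (cong (f l *_) (δ-refl l)) (ℤP.*-identityʳ (f l)))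

infixl 7 _⊙_
_⊙_ : ∀ {m n} → (Fin m → ℤ) → Mat m n → Fin n → ℤ
_⊙_ {m} c X j = Σℤ m (λ l → c l * X l j)

infix 4 _≋_[mod_]
_≋_[mod_] : ∀ {m} → (Fin m → ℤ) → (Fin m → ℤ) → ℕ → Set
c ≋ c' [mod M ] = ∀ l → c l ≡ c' l [mod M ]

0ᵥ : ∀ {m} → Fin m → ℤ
0ᵥ _ = + 0

⊙-assoc : ∀ {m n r} (c : Fin m → ℤ) (X : Mat m n) (Y : Mat n r) j →
          (c ⊙ X ⊙ Y) j ≡ (c ⊙ (X · Y)) j
⊙-assoc {m} {n} c X Y j = begin
  Σℤ n (λ l → Σℤ m (λ i → c i * X i l) * Y l j)
    ≡⟨ Σ-cong n (λ l → Σ-*ʳ m (Y l j) (λ i → c i * X i l)) ⟨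
  Σℤ n (λ l → Σℤ m (λ i → c i * X i l * Y l j))
    ≡⟨ Σ-swap m n (λ i l → c i * X i l * Y l j) ⟨
  Σℤ m (λ i → Σℤ n (λ l → c i * X i l * Y l j))
    ≡⟨ Σ-cong m (λ i → trans (Σ-cong n (λ l → ℤP.*-assoc (c i) (X i l) (Y l j)))
                             (Σ-*ˡ n (c i) (λ l → X i l * Y l j))) ⟩
  Σℤ m (λ i → c i * Σℤ n (λ l → X i l * Y l j)) ∎
  where open ≡-Reasoning

⊙-δ : ∀ {m} (c : Fin m → ℤ) j → (c ⊙ δ) j ≡ c j
⊙-δ {m} c j = Σ-δʳ m j c

⊙-cong : ∀ {m n} {c c' : Fin m → ℤ} (X : Mat m n) → (∀ l → c l ≡ c' l) → ∀ j → (c ⊙ X) j ≡ (c' ⊙ X) j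
⊙-cong {m} X e j = Σ-cong m (λ l → cong (_* X l j) (e l))

⊙-+ : ∀ {m n} (c c' : Fin m → ℤ) (X : Mat m n) j → ((λ l → c l + c' l) ⊙ X) j ≡ (c ⊙ X) j + (c' ⊙ X) j
⊙-+ {m} c c' X j = trans (Σ-cong m (λ l → ℤP.*-distribʳ-+ (X l j) (c l) (c' l))) (Σ-+ m _ _)

⊙-neg : ∀ {m n} (c : Fin m → ℤ) (X : Mat m n) j → ((λ l → - c l) ⊙ X) j ≡ - (c ⊙ X) j
⊙-neg {m} c X j = trans (Σ-cong m (λ l → sym (ℤP.neg-distribˡ-* (c l) (X l j)))) (Σ-neg m _)

⊙-modˡ : ∀ {m n M} {c c' : Fin m → ℤ} (X : Mat m n) → c ≋ c' [mod M ] → c ⊙ X ≋ c' ⊙ X [mod M ]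
⊙-modˡ {m} X e j = Σ-mod m (λ l → mod-*ʳ (X l j) (e l))

⊙-modʳ : ∀ {m n M} (c : Fin m → ℤ) {X X' : Mat m n} → (∀ l j → X l j ≡ X' l j [mod M ]) →
         c ⊙ X ≋ c ⊙ X' [mod M ]
⊙-modʳ {m} c e j = Σ-mod m (λ l → mod-*ˡ (c l) (e l j))

⊙-0 : ∀ {m n M} {c : Fin m → ℤ} (X : Mat m n) → c ≋ 0ᵥ [mod M ] → c ⊙ X ≋ 0ᵥ [mod M ]
⊙-0 {m} X z j = mod-trans (⊙-modˡ X z j) (mod-reflexive (Σ-0 m _ (λ l → ℤP.*-zeroˡ (X l j))))

arcIndicator : ∀ {n} → Fin n → Fin n → Fin n → Fin n → ℤ
arcIndicator x y a b with x F.≟ a | y F.≟ b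
... | yes _ | yes _ = + 1
... | _     | _     = + 0

signedArc : ∀ {n} → Fin n → Fin n → Fin n → Fin n → ℤ
signedArc x y a b = arcIndicator x y a b - arcIndicator y x a b

-- The local indicator in the definition of cnt agrees with arcIndicator
-- once all four equality tests are decided.
cnt-cons : ∀ {n} {R : Fin n → Fin n → Set} {x y z} (r : R x y) (w : Walk R y z) a b →
           cnt (cons r w) a b ≡ signedArc x y a b + cnt w a b
cnt-cons {x = x} {y} r w a b with x F.≟ a | y F.≟ b | y F.≟ a | x F.≟ b
... | yes _ | yes _ | yes _ | yes _ = refl
... | yes _ | yes _ | yes _ | no _  = refl
... | yes _ | yes _ | no _  | yes _ = refl
... | yes _ | yes _ | no _  | no _  = refl
... | yes _ | no _  | yes _ | yes _ = refl
... | yes _ | no _  | yes _ | no _  = refl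
... | yes _ | no _  | no _  | yes _ = refl
... | yes _ | no _  | no _  | no _  = refl
... | no _  | yes _ | yes _ | yes _ = refl
... | no _  | yes _ | yes _ | no _  = refl
... | no _  | yes _ | no _  | yes _ = refl
... | no _  | yes _ | no _  | no _  = refl
... | no _  | no _  | yes _ | yes _ = refl
... | no _  | no _  | yes _ | no _  = refl
... | no _  | no _  | no _  | yes _ = refl
... | no _  | no _  | no _  | no _  = refl

arcIndicator-≡ : ∀ {n} (x y : Fin n) → arcIndicator x y x y ≡ + 1
arcIndicator-≡ x y with x F.≟ x | y F.≟ y
... | yes _ | yes _ = refl
... | no ne | _     = ⊥-elim (ne refl)
... | yes _ | no ne = ⊥-elim (ne refl)

arcIndicator-≢ : ∀ {n} (x y a b : Fin n) → ¬ (x ≡ a × y ≡ b) → arcIndicator x y a b ≡ + 0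
arcIndicator-≢ x y a b ne with x F.≟ a | y F.≟ b
... | yes e | yes f = ⊥-elim (ne (e , f))
... | yes _ | no _  = refl
... | no _  | _     = refl

signedArc-swap : ∀ {n} (x y a b : Fin n) → signedArc y x a b ≡ - signedArc x y a b
signedArc-swap x y a b = regroup (arcIndicator x y a b) (arcIndicator y x a b)
  where
  regroup : ∀ p q → q - p ≡ - (p - q)
  regroup = solve-∀

cnt-++ : ∀ {n} {R : Fin n → Fin n → Set} {x y z} (w : Walk R x y) (w' : Walk R y z) a b →
         cnt (w ++ w') a b ≡ cnt w a b + cnt w' a b
cnt-++ (nil _) w' a b = sym (ℤP.+-identityˡ _)
cnt-++ (cons {x} {y} r w) w' a b = begin
  cnt (cons r (w ++ w')) a b                ≡⟨ cnt-cons r (w ++ w') a b ⟩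
  signedArc x y a b + cnt (w ++ w') a b       ≡⟨ cong (λ v → signedArc x y a b + v) (cnt-++ w w' a b) ⟩
  signedArc x y a b + (cnt w a b + cnt w' a b) ≡⟨ ℤP.+-assoc (signedArc x y a b) _ _ ⟨
  signedArc x y a b + cnt w a b + cnt w' a b   ≡⟨ cong (_+ cnt w' a b) (cnt-cons r w a b) ⟨
  cnt (cons r w) a b + cnt w' a b            ∎
  where open ≡-Reasoning

mapW-++ : ∀ {n} {R R' : Fin n → Fin n → Set} (g : Fin n → Fin n) (f : ∀ {x y} → R x y → R' (g x) (g y))
          {x y z} (w : Walk R x y) (w' : Walk R y z) →
          mapW g f (w ++ w') ≡ mapW {R' = R'} g f w ++ mapW g f w'
mapW-++ g f (nil _)    w' = refl
mapW-++ g f (cons r w) w' = cong (cons (f r)) (mapW-++ g f w w')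

cnt-mapW-id : ∀ {n} {R R' : Fin n → Fin n → Set} (f : ∀ {x y} → R x y → R' x y) {x y} (w : Walk R x y) a b →
              cnt (mapW {R' = R'} (λ v → v) f w) a b ≡ cnt w a b
cnt-mapW-id f (nil _) a b = refl
cnt-mapW-id {R' = R'} f (cons {x} {y} r w) a b =
  trans (cnt-cons {R = R'} (f r) (mapW (λ v → v) f w) a b)
        (trans (cong (λ v → signedArc x y a b + v) (cnt-mapW-id f w a b)) (sym (cnt-cons r w a b)))

arcIndicator-bij : ∀ {n} (g h : Fin n → Fin n) → (∀ x → h (g x) ≡ x) → (∀ x → g (h x) ≡ x) →
                   ∀ x y a b → arcIndicator (g x) (g y) a b ≡ arcIndicator x y (h a) (h b)
arcIndicator-bij g h hg gh x y a b with g x F.≟ a | g y F.≟ b | x F.≟ h a | y F.≟ h b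
... | yes _ | yes _ | yes _ | yes _  = refl
... | yes e | yes _ | no ne | _      = ⊥-elim (ne (trans (sym (hg x)) (cong h e)))
... | yes _ | yes e | yes _ | no ne  = ⊥-elim (ne (trans (sym (hg y)) (cong h e)))
... | no ne | _     | yes e | yes _  = ⊥-elim (ne (trans (cong g e) (gh a)))
... | yes _ | no ne | yes _ | yes e  = ⊥-elim (ne (trans (cong g e) (gh b)))
... | no _  | _     | no _  | _      = refl
... | no _  | _     | yes _ | no _   = refl
... | yes _ | no _  | no _  | _      = refl
... | yes _ | no _  | yes _ | no _   = refl

cnt-mapW : ∀ {n} {R R' : Fin n → Fin n → Set} (g h : Fin n → Fin n) →
           (∀ x → h (g x) ≡ x) → (∀ x → g (h x) ≡ x) →
           (f : ∀ {x y} → R x y → R' (g x) (g y)) → ∀ {x y} (w : Walk R x y) a b →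
           cnt (mapW {R' = R'} g f w) a b ≡ cnt w (h a) (h b)
cnt-mapW g h hg gh f (nil _) a b = refl
cnt-mapW {R' = R'} g h hg gh f (cons {x} {y} r w) a b = begin
  cnt (cons {R = R'} {x = g x} (f r) (mapW g f w)) a b
    ≡⟨ cnt-cons {R = R'} {x = g x} (f r) (mapW g f w) a b ⟩
  arcIndicator (g x) (g y) a b - arcIndicator (g y) (g x) a b + cnt (mapW g f w) a b
    ≡⟨ cong₂ (λ u v → u - v + cnt (mapW g f w) a b)
             (arcIndicator-bij g h hg gh x y a b) (arcIndicator-bij g h hg gh y x a b) ⟩
  signedArc x y (h a) (h b) + cnt (mapW g f w) a b
    ≡⟨ cong (λ v → signedArc x y (h a) (h b) + v) (cnt-mapW g h hg gh f w a b) ⟩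
  signedArc x y (h a) (h b) + cnt w (h a) (h b)
    ≡⟨ cnt-cons r w (h a) (h b) ⟨
  cnt (cons r w) (h a) (h b) ∎
  where open ≡-Reasoning

reverse : ∀ {n} {R : Fin n → Fin n → Set} → (∀ {x y} → R x y → R y x) → ∀ {x y} → Walk R x y → Walk R y x
reverse s (nil x)        = nil x
reverse s (cons {x} r w) = reverse s w ++ cons (s r) (nil x)

cnt-reverse : ∀ {n} {R : Fin n → Fin n → Set} (s : ∀ {x y} → R x y → R y x) {x y} (w : Walk R x y) a b →
              cnt (reverse s w) a b ≡ - cnt w a b
cnt-reverse s (nil x) a b = refl
cnt-reverse {R = R} s (cons {x} {y} r w) a b = begin
  cnt (reverse s w ++ back) a b           ≡⟨ cnt-++ (reverse s w) back a b ⟩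
  cnt (reverse s w) a b + cnt back a b    ≡⟨ cong₂ _+_ (cnt-reverse s w a b) (cnt-cons {R = R} (s r) (nil x) a b) ⟩
  - cnt w a b + (signedArc y x a b + + 0) ≡⟨ cong (λ v → - cnt w a b + (v + + 0)) (signedArc-swap x y a b) ⟩
  - cnt w a b + (- signedArc x y a b + + 0) ≡⟨ regroup (cnt w a b) (signedArc x y a b) ⟩
  - (signedArc x y a b + cnt w a b)       ≡⟨ cong -_ (cnt-cons r w a b) ⟨
  - cnt (cons r w) a b                    ∎
  where
  open ≡-Reasoning
  back : Walk R y x
  back = cons (s r) (nil x)
  regroup : ∀ c d → - c + (- d + + 0) ≡ - (d + c)
  regroup = solve-∀

length : ∀ {n} {R : Fin n → Fin n → Set} {x y} → Walk R x y → ℕ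
length (nil _)    = 0
length (cons _ w) = suc (length w)

ShorterWithSameCounts : ∀ {n} {R : Fin n → Fin n → Set} {x y} → Walk R x y → Set
ShorterWithSameCounts {R = R} {x} {y} w =
  Σ (Walk R x y) λ w' → length w' < length w × (∀ a b → cnt w' a b ≡ cnt w a b)

reduced-or-shorter : ∀ {n} {R : Fin n → Fin n → Set} {x y} (w : Walk R x y) →
                     Reduced w ⊎ ShorterWithSameCounts w
reduced-or-shorter (nil _)          = inj₁ tt
reduced-or-shorter (cons r (nil _)) = inj₁ tt
reduced-or-shorter (cons {x} r (cons {y} {z} r' w)) with x F.≟ z | reduced-or-shorter (cons r' w)
... | yes refl | _ = inj₂ (w , ℕP.≤-trans (ℕP.n<1+n (length w)) (ℕP.n≤1+n _) , backtrack)
  where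
  open ≡-Reasoning
  regroup : ∀ c d → c + (- c + d) ≡ d
  regroup = solve-∀
  backtrack : ∀ a b → cnt w a b ≡ cnt (cons r (cons r' w)) a b
  backtrack a b = sym (begin
    cnt (cons r (cons r' w)) a b                       ≡⟨ cnt-cons r (cons r' w) a b ⟩
    signedArc x y a b + cnt (cons r' w) a b             ≡⟨ cong (λ v → signedArc x y a b + v) (cnt-cons r' w a b) ⟩
    signedArc x y a b + (signedArc y x a b + cnt w a b) ≡⟨ cong (λ v → signedArc x y a b + (v + cnt w a b))
                                                                (signedArc-swap x y a b) ⟩
    signedArc x y a b + (- signedArc x y a b + cnt w a b) ≡⟨ regroup (signedArc x y a b) (cnt w a b) ⟩
    cnt w a b                                           ∎)
... | no x≢z | inj₁ red = inj₁ (x≢z , red)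
... | no _   | inj₂ (w' , shorter , same) =
  inj₂ (cons r w' , s≤s shorter , λ a b →
        trans (cnt-cons r w' a b)
              (trans (cong (λ v → signedArc x y a b + v) (same a b)) (sym (cnt-cons r (cons r' w) a b))))

acyclic⇒cnt≡0 : ∀ {n} {R : Fin n → Fin n → Set} → (∀ x (w : Walk R x x) → Reduced w → IsNil w) →
                ∀ {x} (w : Walk R x x) a b → cnt w a b ≡ + 0
acyclic⇒cnt≡0 {R = R} acyclic w = go (length w) w ℕP.≤-refl
  where
  go : ∀ N {x} (w : Walk R x x) → length w ≤ N → ∀ a b → cnt w a b ≡ + 0
  go N (nil _) _ a b = refl
  go N {x} (cons r w) le a b with reduced-or-shorter (cons r w)
  ... | inj₁ red = ⊥-elim (acyclic x (cons r w) red)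
  go (suc N) (cons r w) le a b | inj₂ (w' , shorter , same) =
    trans (sym (same a b)) (go N w' (ℕP.≤-pred (ℕP.≤-trans shorter le)) a b)

residue-bound : ∀ {m} (x y : Fin m) k → ¬ (+ toℕ x ≡ + toℕ y + + suc k * + m)
residue-bound {m} x y k e =
  ℕP.<⇒≱ (FP.toℕ<n x) (subst (m ≤_) (sym toℕx≡) (ℕP.≤-trans (ℕP.m≤m+n m (k ℕ.* m)) (ℕP.m≤n+m _ (toℕ y))))
  where
  toℕx≡ : toℕ x ≡ toℕ y ℕ.+ suc k ℕ.* m
  toℕx≡ = ℤP.+-injective (trans e (trans (cong (λ v → + toℕ y + v) (sym (ℤP.pos-* (suc k) m)))
                                          (sym (ℤP.pos-+ (toℕ y) (suc k ℕ.* m)))))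

residue-injective : ∀ {m} (x y : Fin m) → + toℕ x ≡ + toℕ y [mod m ] → x ≡ y
residue-injective {m} x y (by (+ zero) e) =
  FP.toℕ-injective (ℤP.+-injective (trans e (trans (cong (λ v → + toℕ y + v) (ℤP.*-zeroˡ (+ m)))
                                                   (ℤP.+-identityʳ _))))
residue-injective x y (by (+ suc k) e) = ⊥-elim (residue-bound x y k e)
residue-injective {m} x y (by -[1+ k ] e) = ⊥-elim (residue-bound y x k (flip (+ toℕ x) (+ toℕ y) (+ k) (+ m) e))
  where
  flip : ∀ x y k m → x ≡ y + (- (+ 1 + k)) * m → y ≡ x + (+ 1 + k) * m
  flip x y k m refl = solve (y ∷ k ∷ m ∷ [])

reduce : ∀ m .{{_ : NonZero m}} → ℤ → Fin m
reduce m z = F.fromℕ< (ℤDM.n%ℕd<d z m)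

reduce-≡ : ∀ m .{{_ : NonZero m}} z → + toℕ (reduce m z) ≡ z [mod m ]
reduce-≡ m z = by (- (z ℤDM./ℕ m)) (begin
  + toℕ (reduce m z)                     ≡⟨ cong +_ (FP.toℕ-fromℕ< (ℤDM.n%ℕd<d z m)) ⟩
  + r                                    ≡⟨ regroup (+ r) q (+ m) ⟩
  + r + q * + m + - q * + m              ≡⟨ cong (_+ - q * + m) (ℤDM.a≡a%ℕn+[a/ℕn]*n z m) ⟨
  z + - q * + m                          ∎)
  where
  open ≡-Reasoning
  r = z ℤDM.%ℕ m
  q = z ℤDM./ℕ m
  regroup : ∀ r q m → r ≡ r + q * m + - q * m
  regroup = solve-∀

mod-residue : ∀ a m → + toℕ (a mod suc m) ≡ + a [mod suc m ]
mod-residue a m = by (- + (a / suc m)) (begin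
  + toℕ (a mod suc m)     ≡⟨ cong +_ (FP.toℕ-fromℕ< (m%n<n a (suc m))) ⟩
  + r                     ≡⟨ regroup (+ r) (+ q) (+ suc m) ⟩
  + r + + q * + suc m + - + q * + suc m
    ≡⟨ cong (_+ - + q * + suc m) (trans (cong (λ v → + r + v) (sym (ℤP.pos-* q (suc m))))
                                        (trans (sym (ℤP.pos-+ r _)) (cong +_ (sym (m≡m%n+[m/n]*n a (suc m)))))) ⟩
  + a + - + q * + suc m   ∎)
  where
  open ≡-Reasoning
  r = a % suc m
  q = a / suc m
  regroup : ∀ r q m → r ≡ r + q * m + - q * m
  regroup = solve-∀

addM-≡ : ∀ {m} (x y : Fin m) → + toℕ (addM x y) ≡ + toℕ x + + toℕ y [mod m ]
addM-≡ {suc m} x y = mod-trans (mod-residue (toℕ x ℕ.+ toℕ y) m) (mod-reflexive (ℤP.pos-+ (toℕ x) (toℕ y)))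

negM-≡ : ∀ {m} (x : Fin m) → + toℕ (negM x) ≡ - + toℕ x [mod m ]
negM-≡ {suc m} x = mod-trans (mod-residue (suc m ℕ.∸ toℕ x) m) (by (+ 1) (begin
  + (suc m ℕ.∸ toℕ x)       ≡⟨ ℤP.⊖-≥ (ℕP.<⇒≤ (FP.toℕ<n x)) ⟨
  suc m ℤ.⊖ toℕ x           ≡⟨ ℤP.-m+n≡n⊖m (toℕ x) (suc m) ⟨
  - + toℕ x + + suc m       ≡⟨ cong (λ v → - + toℕ x + v) (ℤP.*-identityˡ (+ suc m)) ⟨
  - + toℕ x + + 1 * + suc m ∎))
  where open ≡-Reasoning

ι : ∀ {a M} → Elt a M → Fin a → ℤ
ι g j = + toℕ (comp g j)

comp-addE : ∀ {a M} (g h : Elt a M) j → comp (addE g h) j ≡ addM (comp g j) (comp h j)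
comp-addE {suc a} (x , g) (y , h) F.zero    = refl
comp-addE {suc a} (x , g) (y , h) (F.suc j) = comp-addE g h j

comp-negE : ∀ {a M} (g : Elt a M) j → comp (negE g) j ≡ negM (comp g j)
comp-negE {suc a} (x , g) F.zero    = refl
comp-negE {suc a} (x , g) (F.suc j) = comp-negE g j

Elt-ext : ∀ {a M} {g h : Elt a M} → (∀ j → comp g j ≡ comp h j) → g ≡ h
Elt-ext {zero}                    e = refl
Elt-ext {suc a} {g = _ , _} {_ , _} e = cong₂ _,_ (e F.zero) (Elt-ext (e ∘ F.suc))

ι-injective : ∀ {a M} {g h : Elt a M} → (∀ j → ι g j ≡ ι h j [mod M j ]) → g ≡ h
ι-injective e = Elt-ext λ j → residue-injective _ _ (e j)

ι-cong : ∀ {a M} {g h : Elt a M} → g ≡ h → ∀ j → ι g j ≡ ι h j [mod M j ]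
ι-cong {g = g} refl j = mod-refl (ι g j)

ι-addE : ∀ {a M} (g h : Elt a M) j → ι (addE g h) j ≡ ι g j + ι h j [mod M j ]
ι-addE g h j rewrite comp-addE g h j = addM-≡ (comp g j) (comp h j)

ι-negE : ∀ {a M} (g : Elt a M) j → ι (negE g) j ≡ - ι g j [mod M j ]
ι-negE g j rewrite comp-negE g j = negM-≡ (comp g j)

NonZeroModuli : ∀ {a} → (Fin a → ℕ) → Set
NonZeroModuli M = ∀ j → NonZero (M j)

opaque
  fromℤ : ∀ {a M} → NonZeroModuli M → (Fin a → ℤ) → Elt a M
  fromℤ {zero}  nz v = tt
  fromℤ {suc a} nz v = reduce _ {{nz F.zero}} (v F.zero) , fromℤ (nz ∘ F.suc) (v ∘ F.suc)

  comp-fromℤ : ∀ {a M} (nz : NonZeroModuli M) (v : Fin a → ℤ) j →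
               comp (fromℤ nz v) j ≡ reduce (M j) {{nz j}} (v j)
  comp-fromℤ {suc a} nz v F.zero    = refl
  comp-fromℤ {suc a} nz v (F.suc j) = comp-fromℤ (nz ∘ F.suc) (v ∘ F.suc) j

ι-fromℤ : ∀ {a M} (nz : NonZeroModuli M) (v : Fin a → ℤ) j → ι (fromℤ nz v) j ≡ v j [mod M j ]
ι-fromℤ {M = M} nz v j rewrite comp-fromℤ nz v j = reduce-≡ (M j) {{nz j}} (v j)

fromℤ-cong : ∀ {a M} (nz : NonZeroModuli M) {v w : Fin a → ℤ} →
             (∀ j → v j ≡ w j [mod M j ]) → fromℤ nz v ≡ fromℤ nz w
fromℤ-cong nz {v} {w} e = ι-injective λ j →
  mod-trans (ι-fromℤ nz v j) (mod-trans (e j) (mod-sym (ι-fromℤ nz w j)))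

fromℤ-injective : ∀ {a M} (nz : NonZeroModuli M) {v w : Fin a → ℤ} →
                  fromℤ nz v ≡ fromℤ nz w → ∀ j → v j ≡ w j [mod M j ]
fromℤ-injective nz {v} {w} e j =
  mod-trans (mod-sym (ι-fromℤ nz v j)) (mod-trans (ι-cong e j) (ι-fromℤ nz w j))

addE-fromℤ : ∀ {a M} (nz : NonZeroModuli M) (v w : Fin a → ℤ) →
             addE (fromℤ nz v) (fromℤ nz w) ≡ fromℤ nz (λ j → v j + w j)
addE-fromℤ nz v w = ι-injective λ j →
  mod-trans (ι-addE (fromℤ nz v) (fromℤ nz w) j)
            (mod-trans (mod-+ (ι-fromℤ nz v j) (ι-fromℤ nz w j)) (mod-sym (ι-fromℤ nz _ j)))

negE-fromℤ : ∀ {a M} (nz : NonZeroModuli M) (v : Fin a → ℤ) → negE (fromℤ nz v) ≡ fromℤ nz (λ j → - v j)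
negE-fromℤ nz v = ι-injective λ j →
  mod-trans (ι-negE (fromℤ nz v) j) (mod-trans (mod-neg (ι-fromℤ nz v j)) (mod-sym (ι-fromℤ nz _ j)))

_≟E_ : ∀ {a M} (g h : Elt a M) → Dec (g ≡ h)
_≟E_ {zero}  tt tt = yes refl
_≟E_ {suc a} (x , g) (y , h) with x F.≟ y | g ≟E h
... | yes refl | yes refl = yes refl
... | no ne    | _        = no λ { refl → ne refl }
... | yes _    | no ne    = no λ { refl → ne refl }

module EltGroup {a : ℕ} {M : Fin a → ℕ} (nz : NonZeroModuli M) where

  0E : Elt a M
  0E = fromℤ nz 0ᵥ

  ι-0E : ∀ j → ι 0E j ≡ + 0 [mod M j ]
  ι-0E = ι-fromℤ nz 0ᵥ

  addE-comm : ∀ (g h : Elt a M) → addE g h ≡ addE h g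
  addE-comm g h = ι-injective λ j →
    mod-trans (ι-addE g h j) (mod-trans (mod-reflexive (ℤP.+-comm (ι g j) (ι h j))) (mod-sym (ι-addE h g j)))

  addE-assoc : ∀ (g h k : Elt a M) → addE (addE g h) k ≡ addE g (addE h k)
  addE-assoc g h k = ι-injective λ j →
    mod-trans (ι-addE (addE g h) k j)
   (mod-trans (mod-+ (ι-addE g h j) (mod-refl (ι k j)))
   (mod-trans (mod-reflexive (ℤP.+-assoc (ι g j) (ι h j) (ι k j)))
   (mod-sym (mod-trans (ι-addE g (addE h k) j) (mod-+ (mod-refl (ι g j)) (ι-addE h k j))))))

  addE-identityˡ : ∀ (g : Elt a M) → addE 0E g ≡ g
  addE-identityˡ g = ι-injective λ j →
    mod-trans (ι-addE 0E g j) (mod-trans (mod-+ (ι-0E j) (mod-refl (ι g j))) (mod-reflexive (ℤP.+-identityˡ (ι g j))))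

  addE-identityʳ : ∀ (g : Elt a M) → addE g 0E ≡ g
  addE-identityʳ g = trans (addE-comm g 0E) (addE-identityˡ g)

  addE-inverseʳ : ∀ (g : Elt a M) → addE g (negE g) ≡ 0E
  addE-inverseʳ g = ι-injective λ j →
    mod-trans (ι-addE g (negE g) j)
   (mod-trans (mod-+ (mod-refl (ι g j)) (ι-negE g j))
   (mod-trans (mod-reflexive (ℤP.+-inverseʳ (ι g j))) (mod-sym (ι-0E j))))

  addE-inverseˡ : ∀ (g : Elt a M) → addE (negE g) g ≡ 0E
  addE-inverseˡ g = trans (addE-comm (negE g) g) (addE-inverseʳ g)

  negE-addE : ∀ (g h : Elt a M) → negE (addE g h) ≡ addE (negE g) (negE h)
  negE-addE g h = ι-injective λ j →
    mod-trans (ι-negE (addE g h) j)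
   (mod-trans (mod-neg (ι-addE g h j))
   (mod-trans (mod-reflexive (ℤP.neg-distrib-+ (ι g j) (ι h j)))
   (mod-sym (mod-trans (ι-addE (negE g) (negE h) j) (mod-+ (ι-negE g j) (ι-negE h j))))))

  negE-involutive : ∀ (g : Elt a M) → negE (negE g) ≡ g
  negE-involutive g = ι-injective λ j →
    mod-trans (ι-negE (negE g) j) (mod-trans (mod-neg (ι-negE g j)) (mod-reflexive (ℤP.neg-involutive (ι g j))))

  sub-add : ∀ (g h : Elt a M) → addE (addE g (negE h)) h ≡ g
  sub-add g h = trans (addE-assoc g (negE h) h) (trans (cong (addE g) (addE-inverseˡ h)) (addE-identityʳ g))

  add-sub : ∀ (g h : Elt a M) → addE (addE g h) (negE h) ≡ g
  add-sub g h = trans (addE-assoc g h (negE h)) (trans (cong (addE g) (addE-inverseʳ h)) (addE-identityʳ g))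

  addE-cancelʳ : ∀ (g h k : Elt a M) → addE g k ≡ addE h k → g ≡ h
  addE-cancelʳ g h k e = begin
    g                         ≡⟨ add-sub g k ⟨
    addE (addE g k) (negE k)  ≡⟨ cong (λ z → addE z (negE k)) e ⟩
    addE (addE h k) (negE k)  ≡⟨ add-sub h k ⟩
    h                         ∎
    where open ≡-Reasoning

  negE-sub : ∀ (g h : Elt a M) → negE (addE g (negE h)) ≡ addE h (negE g)
  negE-sub g h = begin
    negE (addE g (negE h))          ≡⟨ negE-addE g (negE h) ⟩
    addE (negE g) (negE (negE h))   ≡⟨ cong (addE (negE g)) (negE-involutive h) ⟩
    addE (negE g) h                 ≡⟨ addE-comm (negE g) h ⟩
    addE h (negE g)                 ∎
    where open ≡-Reasoning

  sub-sub-cancel : ∀ (g h k : Elt a M) → addE (negE (addE g (negE h))) (addE g (negE k)) ≡ addE h (negE k)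
  sub-sub-cancel g h k = begin
    addE (negE (addE g (negE h))) (addE g (negE k))  ≡⟨ cong (λ z → addE z (addE g (negE k))) (negE-sub g h) ⟩
    addE (addE h (negE g)) (addE g (negE k))         ≡⟨ addE-assoc h (negE g) _ ⟩
    addE h (addE (negE g) (addE g (negE k)))         ≡⟨ cong (addE h) (addE-assoc (negE g) g (negE k)) ⟨
    addE h (addE (addE (negE g) g) (negE k))         ≡⟨ cong (λ z → addE h (addE z (negE k))) (addE-inverseˡ g) ⟩
    addE h (addE 0E (negE k))                        ≡⟨ cong (addE h) (addE-identityˡ (negE k)) ⟩
    addE h (negE k)                                  ∎
    where open ≡-Reasoning

  add-sub-assoc : ∀ (g h k : Elt a M) → addE (addE g h) (negE k) ≡ addE g (negE (addE k (negE h)))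
  add-sub-assoc g h k = trans (addE-assoc g h (negE k)) (cong (addE g) (sym (negE-sub k h)))

does-true : ∀ {P : Set} (d : Dec P) → does d ≡ true → P
does-true (yes p) _ = p

is-just⇒just : ∀ {A : Set} (m : Maybe A) → Maybe.is-just m ≡ true → Σ A λ x → m ≡ just x
is-just⇒just (just x) _ = x , refl

is-just-just : ∀ {A : Set} {m : Maybe A} {x} → m ≡ just x → Maybe.is-just m ≡ true
is-just-just refl = refl

bool-ext : ∀ {b b' : Bool} → (b ≡ true → b' ≡ true) → (b' ≡ true → b ≡ true) → b ≡ b'
bool-ext {true}  {true}  f g = refl
bool-ext {true}  {false} f g = sym (f refl)
bool-ext {false} {true}  f g = g refl
bool-ext {false} {false} f g = refl

firstJust : ∀ {m} {B : Set} → (Fin m → Maybe B) → Maybe B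
firstJust {zero}  f = nothing
firstJust {suc m} f with f F.zero
... | just b  = just b
... | nothing = firstJust (f ∘ F.suc)

firstJust-cong : ∀ {m} {B : Set} {f f' : Fin m → Maybe B} → (∀ i → f i ≡ f' i) → firstJust f ≡ firstJust f'
firstJust-cong {zero}                 e = refl
firstJust-cong {suc m} {f = f} {f'} e with f F.zero | f' F.zero | e F.zero
... | just b  | .(just b) | refl = refl
... | nothing | .nothing  | refl = firstJust-cong (e ∘ F.suc)

firstJust-sound : ∀ {m} {B : Set} (f : Fin m → Maybe B) {b} → firstJust f ≡ just b → ∃ λ i → f i ≡ just b
firstJust-sound {suc m} f e with f F.zero in eq
firstJust-sound {suc m} f refl | just b = F.zero , eq
... | nothing with firstJust-sound (f ∘ F.suc) e
... | i , e' = F.suc i , e'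

firstJust-complete : ∀ {m} {B : Set} (f : Fin m → Maybe B) i {b} → f i ≡ just b → ∃ λ b' → firstJust f ≡ just b'
firstJust-complete {suc m} f F.zero    e rewrite e = _ , refl
firstJust-complete {suc m} f (F.suc i) e with f F.zero
... | just b  = b , refl
... | nothing = firstJust-complete (f ∘ F.suc) i e

search : ∀ {a M} → (Elt a M → Bool) → Maybe (Elt a M)
search {zero}      P = if P tt then just tt else nothing
search {suc a} {M} P = firstJust (λ x → Maybe.map (x ,_) (search {a} {M ∘ F.suc} (λ g → P (x , g))))

search-cong : ∀ {a M} {P P' : Elt a M → Bool} → (∀ e → P e ≡ P' e) → search P ≡ search P'
search-cong {zero}      e rewrite e tt = refl
search-cong {suc a} {M} e =
  firstJust-cong λ x → cong (Maybe.map (x ,_)) (search-cong {a} {M ∘ F.suc} (λ g → e (x , g)))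

search-sound : ∀ {a M} (P : Elt a M → Bool) {e} → search P ≡ just e → P e ≡ true
search-sound {zero} P eq with P tt in q
search-sound {zero} P refl | true  = q
search-sound {zero} P ()   | false
search-sound {suc a} {M} P {x , g} eq with firstJust-sound _ eq
... | y , e' with search {a} {M ∘ F.suc} (λ h → P (y , h)) in q
search-sound {suc a} {M} P {x , g} eq | y , refl | just .g = search-sound {a} {M ∘ F.suc} (λ h → P (y , h)) q

search-complete : ∀ {a M} (P : Elt a M → Bool) e → P e ≡ true → ∃ λ e' → search P ≡ just e'
search-complete {zero}      P tt pe rewrite pe = tt , refl
search-complete {suc a} {M} P (x , g) pe with search-complete {a} {M ∘ F.suc} (λ h → P (x , h)) g pe
... | g' , q = firstJust-complete (λ y → Maybe.map (y ,_) (search {a} {M ∘ F.suc} (λ h → P (y , h))))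
                                  x (cong (Maybe.map (x ,_)) q)

-- Cycle coordinates with respect to the basis L₁ … Lₜ

module CycleCoordinates {n : ℕ} (Γ : Graph n) (T : SpanningTree Γ) (Wk : TreeWalks T) (v0 : Fin n)
                        (t : ℕ) (C : Cotree T t) where

  open Graph Γ using (Adj; irrefl) renaming (sym to gsym)
  open SpanningTree T
  open TreeWalks Wk
  open Cotree C

  Lᵢ : Fin t → Walk Adj v0 v0
  Lᵢ = L Wk C v0

  treePath : ∀ x y → Walk Adj x y
  treePath x y = mapW (λ z → z) sub (W x y)

  coord : ∀ {x y} → Walk Adj x y → Fin t → ℤ
  coord w i = cnt w (u i) (v i)

  signedArc-tree-cotree : ∀ {x y} → TAdj x y → ∀ l → signedArc x y (u l) (v l) ≡ + 0
  signedArc-tree-cotree {x} {y} r l =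
    cong₂ _-_ (arcIndicator-≢ x y (u l) (v l) λ { (refl , refl) → notT l r })
              (arcIndicator-≢ y x (u l) (v l) λ { (refl , refl) → notT l (Tsym r) })

  coord-tree : ∀ {x y} (w : Walk TAdj x y) l → cnt w (u l) (v l) ≡ + 0
  coord-tree (nil _)    l = refl
  coord-tree (cons r w) l =
    trans (cnt-cons {R = TAdj} r w (u l) (v l)) (cong₂ _+_ (signedArc-tree-cotree r l) (coord-tree w l))

  coord-treePath : ∀ x y l → coord (treePath x y) l ≡ + 0
  coord-treePath x y l = trans (cnt-mapW-id {R = TAdj} sub (W x y) (u l) (v l)) (coord-tree (W x y) l)

  cnt-tree-closed : ∀ {x} (w : Walk TAdj x x) a b → cnt w a b ≡ + 0
  cnt-tree-closed = acyclic⇒cnt≡0 acyclic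

  cnt-treePath-back : ∀ x y a b → cnt (treePath x y) a b + cnt (treePath y x) a b ≡ + 0
  cnt-treePath-back x y a b = begin
    cnt (treePath x y) a b + cnt (treePath y x) a b
      ≡⟨ cong₂ _+_ (cnt-mapW-id {R = TAdj} sub (W x y) a b) (cnt-mapW-id {R = TAdj} sub (W y x) a b) ⟩
    cnt (W x y) a b + cnt (W y x) a b   ≡⟨ cnt-++ (W x y) (W y x) a b ⟨
    cnt (W x y ++ W y x) a b            ≡⟨ cnt-tree-closed (W x y ++ W y x) a b ⟩
    + 0                                 ∎
    where open ≡-Reasoning

  signedArc-cotree : ∀ i l → signedArc (u i) (v i) (u l) (v l) ≡ δ i l
  signedArc-cotree i l with i F.≟ l
  ... | yes refl =
    trans (cong₂ _-_ (arcIndicator-≡ (u i) (v i))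
                     (arcIndicator-≢ (v i) (u i) (u i) (v i)
                        λ { (e , _) → irrefl (subst (λ z → Adj z (v i)) (sym e) (adj i)) }))
          (sym (δ-refl i))
  ... | no i≢l =
    trans (cong₂ _-_ (arcIndicator-≢ (u i) (v i) (u l) (v l) λ { (e , f) → i≢l (inj i l (inj₁ (e , f))) })
                     (arcIndicator-≢ (v i) (u i) (u l) (v l) λ { (e , f) → i≢l (inj i l (inj₂ (f , e))) }))
          (sym (δ-distinct i l i≢l))

  cnt-L : ∀ i a b → cnt (Lᵢ i) a b ≡ cnt (treePath v0 (u i)) a b + (signedArc (u i) (v i) a b + cnt (treePath (v i) v0) a b)
  cnt-L i a b = trans (cnt-++ (treePath v0 (u i)) (cons (adj i) (treePath (v i) v0)) a b)
                      (cong (λ z → cnt (treePath v0 (u i)) a b + z) (cnt-cons {R = Adj} (adj i) (treePath (v i) v0) a b))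

  coord-L : ∀ i l → coord (Lᵢ i) l ≡ δ i l
  coord-L i l = begin
    coord (Lᵢ i) l
      ≡⟨ cnt-L i (u l) (v l) ⟩
    coord (treePath v0 (u i)) l + (signedArc (u i) (v i) (u l) (v l) + coord (treePath (v i) v0) l)
      ≡⟨ cong₂ (λ p q → p + (signedArc (u i) (v i) (u l) (v l) + q)) (coord-treePath v0 (u i) l) (coord-treePath (v i) v0 l) ⟩
    + 0 + (signedArc (u i) (v i) (u l) (v l) + + 0)
      ≡⟨ trans (ℤP.+-identityˡ _) (ℤP.+-identityʳ _) ⟩
    signedArc (u i) (v i) (u l) (v l)
      ≡⟨ signedArc-cotree i l ⟩
    δ i l ∎
    where open ≡-Reasoning

  data ArcKind (x y : Fin n) : Set where
    forward  : (l : Fin t) → u l ≡ x → v l ≡ y → ArcKind x y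
    backward : (l : Fin t) → u l ≡ y → v l ≡ x → ArcKind x y
    neither  : (∀ l → ¬ (u l ≡ x × v l ≡ y)) → (∀ l → ¬ (u l ≡ y × v l ≡ x)) → ArcKind x y

  classify : ∀ x y → ArcKind x y
  classify x y with FP.any? (λ l → (u l F.≟ x) ×-dec (v l F.≟ y))
  ... | yes (l , e , f) = forward l e f
  ... | no ¬fwd with FP.any? (λ l → (u l F.≟ y) ×-dec (v l F.≟ x))
  ...   | yes (l , e , f) = backward l e f
  ...   | no ¬bwd = neither (λ l p → ¬fwd (l , p)) (λ l p → ¬bwd (l , p))

  -- Only ¬¬ TAdj is available: the tree relation need not be decidable.
  neither⇒tree : ∀ {x y} → Adj x y → (∀ l → ¬ (u l ≡ x × v l ≡ y)) → (∀ l → ¬ (u l ≡ y × v l ≡ x)) →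
                 ¬ ¬ TAdj x y
  neither⇒tree r ¬fwd ¬bwd ¬tree with cover _ _ r ¬tree
  ... | l , inj₁ p = ¬fwd l p
  ... | l , inj₂ p = ¬bwd l p

  neither⇒signedArc≡0 : ∀ {x y} → (∀ l → ¬ (u l ≡ x × v l ≡ y)) → (∀ l → ¬ (u l ≡ y × v l ≡ x)) →
                        ∀ i → signedArc x y (u i) (v i) ≡ + 0
  neither⇒signedArc≡0 {x} {y} ¬fwd ¬bwd i =
    cong₂ _-_ (arcIndicator-≢ x y (u i) (v i) λ { (e , f) → ¬fwd i (sym e , sym f) })
              (arcIndicator-≢ y x (u i) (v i) λ { (e , f) → ¬bwd i (sym e , sym f) })

  -- Arc counts of the closed walk W(v₀,x) (x → y) W(y,v₀).
  closure : Fin n → Fin n → Fin n → Fin n → ℤ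
  closure x y a b = cnt (treePath v0 x) a b + signedArc x y a b + cnt (treePath y v0) a b

  closure-cotree : ∀ l a b → closure (u l) (v l) a b ≡ cnt (Lᵢ l) a b
  closure-cotree l a b =
    trans (ℤP.+-assoc (cnt (treePath v0 (u l)) a b) (signedArc (u l) (v l) a b) (cnt (treePath (v l) v0) a b))
          (sym (cnt-L l a b))

  closure-swap : ∀ x y a b → closure y x a b ≡ - closure x y a b
  closure-swap x y a b = begin
    A + signedArc y x a b + Q   ≡⟨ cong (λ z → A + z + Q) (signedArc-swap x y a b) ⟩
    A + - e + Q                 ≡⟨ regroup A B P Q e ⟩
    (A + B) + (Q + P) - (P + e + B)
      ≡⟨ cong₂ (λ z w → z + w - (P + e + B)) (cnt-treePath-back v0 y a b) (cnt-treePath-back x v0 a b) ⟩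
    + 0 + + 0 - (P + e + B)     ≡⟨ ℤP.+-identityˡ _ ⟩
    - (P + e + B)               ∎
    where
    open ≡-Reasoning
    A = cnt (treePath v0 y) a b
    B = cnt (treePath y v0) a b
    P = cnt (treePath v0 x) a b
    Q = cnt (treePath x v0) a b
    e = signedArc x y a b
    regroup : ∀ A B P Q e → A + - e + Q ≡ (A + B) + (Q + P) - (P + e + B)
    regroup = solve-∀

  closure-tree : ∀ {x y} → TAdj x y → ∀ a b → closure x y a b ≡ + 0
  closure-tree {x} {y} r a b = begin
    closure x y a b
      ≡⟨ cong₂ (λ z w → z + signedArc x y a b + w)
               (cnt-mapW-id {R = TAdj} sub (W v0 x) a b) (cnt-mapW-id {R = TAdj} sub (W y v0) a b) ⟩
    cnt (W v0 x) a b + signedArc x y a b + cnt (W y v0) a b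
      ≡⟨ ℤP.+-assoc (cnt (W v0 x) a b) _ _ ⟩
    cnt (W v0 x) a b + (signedArc x y a b + cnt (W y v0) a b)
      ≡⟨ cong (λ z → cnt (W v0 x) a b + z) (cnt-cons {R = TAdj} r (W y v0) a b) ⟨
    cnt (W v0 x) a b + cnt (cons r (W y v0)) a b
      ≡⟨ cnt-++ (W v0 x) (cons r (W y v0)) a b ⟨
    cnt (W v0 x ++ cons r (W y v0)) a b
      ≡⟨ cnt-tree-closed (W v0 x ++ cons r (W y v0)) a b ⟩
    + 0 ∎
    where open ≡-Reasoning

  combination : (Fin t → ℤ) → Fin n → Fin n → ℤ
  combination c a b = Σℤ t (λ i → c i * cnt (Lᵢ i) a b)

  arcCoord : Fin n → Fin n → Fin t → ℤ
  arcCoord x y i = signedArc x y (u i) (v i)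

  Σ-arcCoord-cotree : ∀ l (f : Fin t → ℤ) → Σℤ t (λ i → arcCoord (u l) (v l) i * f i) ≡ f l
  Σ-arcCoord-cotree l f = trans (Σ-cong t (λ i → cong (_* f i) (signedArc-cotree l i))) (Σ-δˡ t l f)

  Σ-arcCoord-swap : ∀ x y (f : Fin t → ℤ) →
                    Σℤ t (λ i → arcCoord y x i * f i) ≡ - Σℤ t (λ i → arcCoord x y i * f i)
  Σ-arcCoord-swap x y f =
    trans (Σ-cong t (λ i → trans (cong (_* f i) (signedArc-swap x y (u i) (v i)))
                                 (sym (ℤP.neg-distribˡ-* (arcCoord x y i) (f i)))))
          (Σ-neg t _)

  Σ-arcCoord-neither : ∀ {x y} → (∀ l → ¬ (u l ≡ x × v l ≡ y)) → (∀ l → ¬ (u l ≡ y × v l ≡ x)) →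
                       ∀ (f : Fin t → ℤ) → Σℤ t (λ i → arcCoord x y i * f i) ≡ + 0
  Σ-arcCoord-neither ¬fwd ¬bwd f =
    Σ-0 t _ (λ i → trans (cong (_* f i) (neither⇒signedArc≡0 ¬fwd ¬bwd i)) (ℤP.*-zeroˡ (f i)))

  closure-in-basis : ∀ {x y} → Adj x y → ∀ a b → closure x y a b ≡ combination (arcCoord x y) a b
  closure-in-basis {x} {y} r a b with classify x y
  ... | forward l refl refl = trans (closure-cotree l a b) (sym (Σ-arcCoord-cotree l _))
  ... | backward l refl refl =
    trans (closure-swap (u l) (v l) a b)
          (trans (cong -_ (trans (closure-cotree l a b) (sym (Σ-arcCoord-cotree l _))))
                 (sym (Σ-arcCoord-swap (u l) (v l) _)))
  ... | neither ¬fwd ¬bwd =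
    trans (decidable-stable (_ ℤ.≟ _) (λ ne → neither⇒tree r ¬fwd ¬bwd (λ tr → ne (closure-tree tr a b))))
          (sym (Σ-arcCoord-neither ¬fwd ¬bwd _))

  cnt-walk-in-basis : ∀ {x y} (w : Walk Adj x y) a b →
    cnt (treePath v0 x) a b + cnt w a b + cnt (treePath y v0) a b ≡ combination (coord w) a b
  cnt-walk-in-basis (nil x) a b =
    trans (trans (cong (_+ cnt (treePath x v0) a b) (ℤP.+-identityʳ (cnt (treePath v0 x) a b)))
                 (cnt-treePath-back v0 x a b))
          (sym (Σ-0 t _ (λ i → ℤP.*-zeroˡ (cnt (Lᵢ i) a b))))
  cnt-walk-in-basis {x} {y} (cons {y = z} r w) a b = begin
    P + cnt (cons r w) a b + Qy                ≡⟨ cong (λ s → P + s + Qy) (cnt-cons {R = Adj} r w a b) ⟩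
    P + (e + cw) + Qy                          ≡⟨ regroup P e cw Qy Pz Qz ⟩
    (P + e + Qz) + (Pz + cw + Qy) - (Qz + Pz)  ≡⟨ cong₂ (λ s s' → s + s' - (Qz + Pz))
                                                       (closure-in-basis r a b) (cnt-walk-in-basis w a b) ⟩
    (Σarc + Σw) - (Qz + Pz)                    ≡⟨ cong (λ s → (Σarc + Σw) - s) (cnt-treePath-back z v0 a b) ⟩
    (Σarc + Σw) - + 0                          ≡⟨ ℤP.+-identityʳ _ ⟩
    Σarc + Σw                                  ≡⟨ Σ-+ t _ _ ⟨
    Σℤ t (λ i → arcCoord x z i * cnt (Lᵢ i) a b + coord w i * cnt (Lᵢ i) a b)
      ≡⟨ Σ-cong t (λ i → trans (sym (ℤP.*-distribʳ-+ _ (arcCoord x z i) (coord w i)))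
                               (cong (_* cnt (Lᵢ i) a b) (sym (cnt-cons {R = Adj} r w (u i) (v i))))) ⟩
    combination (coord (cons r w)) a b ∎
    where
    open ≡-Reasoning
    P  = cnt (treePath v0 x) a b
    Qy = cnt (treePath y v0) a b
    Pz = cnt (treePath v0 z) a b
    Qz = cnt (treePath z v0) a b
    e  = signedArc x z a b
    cw = cnt w a b
    Σarc = combination (arcCoord x z) a b
    Σw   = combination (coord w) a b
    regroup : ∀ P e cw Qy Pz Qz → P + (e + cw) + Qy ≡ (P + e + Qz) + (Pz + cw + Qy) - (Qz + Pz)
    regroup = solve-∀

  cnt-closed-in-basis : ∀ {x} (w : Walk Adj x x) a b → cnt w a b ≡ combination (coord w) a b
  cnt-closed-in-basis {x} w a b = begin
    cnt w a b                             ≡⟨ regroup P (cnt w a b) Q ⟩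
    P + cnt w a b + Q - (P + Q)           ≡⟨ cong (λ s → P + cnt w a b + Q - s) (cnt-treePath-back v0 x a b) ⟩
    P + cnt w a b + Q - + 0               ≡⟨ ℤP.+-identityʳ _ ⟩
    P + cnt w a b + Q                     ≡⟨ cnt-walk-in-basis w a b ⟩
    combination (coord w) a b             ∎
    where
    open ≡-Reasoning
    P = cnt (treePath v0 x) a b
    Q = cnt (treePath x v0) a b
    regroup : ∀ P c Q → c ≡ P + c + Q - (P + Q)
    regroup = solve-∀

  closedWalk : ∀ {x y} → Adj x y → Walk Adj v0 v0
  closedWalk {x} {y} r = treePath v0 x ++ cons r (treePath y v0)

  coord-closedWalk : ∀ {x y} (r : Adj x y) l → coord (closedWalk r) l ≡ coord (cons r (nil y)) l
  coord-closedWalk {x} {y} r l = begin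
    coord (closedWalk r) l
      ≡⟨ cnt-++ (treePath v0 x) (cons r (treePath y v0)) (u l) (v l) ⟩
    coord (treePath v0 x) l + coord (cons r (treePath y v0)) l
      ≡⟨ cong₂ _+_ (coord-treePath v0 x l) (cnt-cons {R = Adj} r (treePath y v0) (u l) (v l)) ⟩
    + 0 + (arcCoord x y l + coord (treePath y v0) l)
      ≡⟨ trans (ℤP.+-identityˡ _) (cong (λ v → arcCoord x y l + v) (coord-treePath y v0 l)) ⟩
    arcCoord x y l + + 0
      ≡⟨ cnt-cons {R = Adj} r (nil y) (u l) (v l) ⟨
    coord (cons r (nil y)) l ∎
    where open ≡-Reasoning

  repeatWalk : Walk Adj v0 v0 → ℕ → Walk Adj v0 v0
  repeatWalk w zero    = nil v0
  repeatWalk w (suc k) = w ++ repeatWalk w k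

  coord-repeatWalk : ∀ w k l → coord (repeatWalk w k) l ≡ + k * coord w l
  coord-repeatWalk w zero    l = sym (ℤP.*-zeroˡ (coord w l))
  coord-repeatWalk w (suc k) l =
    trans (cnt-++ w (repeatWalk w k) (u l) (v l))
          (trans (cong (λ s → coord w l + s) (coord-repeatWalk w k l)) (regroup (coord w l) (+ k)))
    where
    regroup : ∀ c k → c + k * c ≡ (+ 1 + k) * c
    regroup = solve-∀

  multipleOfL : Fin t → ℤ → Walk Adj v0 v0
  multipleOfL i (+ k)    = repeatWalk (Lᵢ i) k
  multipleOfL i -[1+ k ] = repeatWalk (reverse gsym (Lᵢ i)) (suc k)

  coord-multipleOfL : ∀ i z l → coord (multipleOfL i z) l ≡ z * δ i l
  coord-multipleOfL i (+ k) l = trans (coord-repeatWalk (Lᵢ i) k l) (cong (+ k *_) (coord-L i l))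
  coord-multipleOfL i -[1+ k ] l =
    trans (coord-repeatWalk (reverse gsym (Lᵢ i)) (suc k) l)
          (trans (cong (+ suc k *_) (trans (cnt-reverse gsym (Lᵢ i) (u l) (v l)) (cong -_ (coord-L i l))))
                 (regroup (+ suc k) (δ i l)))
    where
    regroup : ∀ k d → k * (- d) ≡ (- k) * d
    regroup = solve-∀

  concatWalks : ∀ k → (Fin k → Walk Adj v0 v0) → Walk Adj v0 v0
  concatWalks zero    f = nil v0
  concatWalks (suc k) f = f F.zero ++ concatWalks k (f ∘ F.suc)

  coord-concatWalks : ∀ k f l → coord (concatWalks k f) l ≡ Σℤ k (λ i → coord (f i) l)
  coord-concatWalks zero    f l = refl
  coord-concatWalks (suc k) f l =
    trans (cnt-++ (f F.zero) (concatWalks k (f ∘ F.suc)) (u l) (v l))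
          (cong (λ s → coord (f F.zero) l + s) (coord-concatWalks k (f ∘ F.suc) l))

  realize : (Fin t → ℤ) → Walk Adj v0 v0
  realize c = concatWalks t (λ i → multipleOfL i (c i))

  coord-realize : ∀ c l → coord (realize c) l ≡ c l
  coord-realize c l = trans (coord-concatWalks t _ l)
                            (trans (Σ-cong t (λ i → coord-multipleOfL i (c i) l)) (Σ-δʳ t l c))

module WalkVoltages {n : ℕ} (Γ : Graph n) (T : SpanningTree Γ) (Wk : TreeWalks T) (v0 : Fin n)
                    (t : ℕ) (C : Cotree T t) {a : ℕ} {M : Fin a → ℕ}
                    (V : Voltage Γ a M) (reduced : TReduced T V) where

  open Graph Γ using (Adj)
  open SpanningTree T
  open TreeWalks Wk
  open Cotree C
  open Voltage V
  open CycleCoordinates Γ T Wk v0 t C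

  Θ : Mat t a
  Θ i j = volℤ V (Lᵢ i) j

  volℤ-++ : ∀ {x y z} (w : Walk Adj x y) (w' : Walk Adj y z) j → volℤ V (w ++ w') j ≡ volℤ V w j + volℤ V w' j
  volℤ-++ (nil _) w' j = sym (ℤP.+-identityˡ _)
  volℤ-++ (cons {x} {y} r w) w' j =
    trans (cong (λ s → ι (φ x y) j + s) (volℤ-++ w w' j)) (sym (ℤP.+-assoc (ι (φ x y) j) (volℤ V w j) (volℤ V w' j)))

  volℤ-tree : ∀ {x y} (w : Walk TAdj x y) j → volℤ V (mapW {R' = Adj} (λ z → z) sub w) j ≡ + 0
  volℤ-tree (nil _)    j = refl
  volℤ-tree (cons r w) j rewrite reduced r j | volℤ-tree w j = refl

  Θ≡φ : ∀ i j → Θ i j ≡ ι (φ (u i) (v i)) j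
  Θ≡φ i j = begin
    volℤ V (treePath v0 (u i) ++ cons (adj i) (treePath (v i) v0)) j
      ≡⟨ volℤ-++ (treePath v0 (u i)) _ j ⟩
    volℤ V (treePath v0 (u i)) j + (ι (φ (u i) (v i)) j + volℤ V (treePath (v i) v0) j)
      ≡⟨ cong₂ (λ p q → p + (ι (φ (u i) (v i)) j + q)) (volℤ-tree (W v0 (u i)) j) (volℤ-tree (W (v i) v0) j) ⟩
    + 0 + (ι (φ (u i) (v i)) j + + 0)
      ≡⟨ trans (ℤP.+-identityˡ _) (ℤP.+-identityʳ _) ⟩
    ι (φ (u i) (v i)) j ∎
    where open ≡-Reasoning

  volℤ-arc : ∀ {x y} → Adj x y → ∀ j → ι (φ x y) j ≡ (arcCoord x y ⊙ Θ) j [mod M j ]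
  volℤ-arc {x} {y} r j with classify x y
  ... | forward l refl refl = mod-reflexive (trans (sym (Θ≡φ l j)) (sym (Σ-arcCoord-cotree l (λ i → Θ i j))))
  ... | backward l refl refl =
    mod-trans (mod-reflexive (cong (λ g → ι g j) (anti (adj l))))
              (mod-trans (ι-negE (φ (u l) (v l)) j)
                         (mod-reflexive (trans (cong -_ (trans (sym (Θ≡φ l j)) (sym (Σ-arcCoord-cotree l (λ i → Θ i j)))))
                                               (sym (Σ-arcCoord-swap (u l) (v l) (λ i → Θ i j))))))
  ... | neither ¬fwd ¬bwd = mod-reflexive
    (trans (cong +_ (decidable-stable (_ ℕ.≟ _) (λ ne → neither⇒tree r ¬fwd ¬bwd (λ tr → ne (reduced tr j)))))
           (sym (Σ-arcCoord-neither ¬fwd ¬bwd (λ i → Θ i j))))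

  volℤ-in-basis : ∀ {x y} (w : Walk Adj x y) j → volℤ V w j ≡ (coord w ⊙ Θ) j [mod M j ]
  volℤ-in-basis (nil x) j = mod-reflexive (sym (Σ-0 t _ (λ i → ℤP.*-zeroˡ (Θ i j))))
  volℤ-in-basis (cons {x} {y} r w) j = mod-trans (mod-+ (volℤ-arc r j) (volℤ-in-basis w j)) (mod-reflexive (begin
    (arcCoord x y ⊙ Θ) j + (coord w ⊙ Θ) j              ≡⟨ ⊙-+ (arcCoord x y) (coord w) Θ j ⟨
    ((λ i → arcCoord x y i + coord w i) ⊙ Θ) j          ≡⟨ ⊙-cong Θ (λ i → sym (cnt-cons {R = Adj} r w (u i) (v i))) j ⟩
    (coord (cons r w) ⊙ Θ) j                            ∎))
    where open ≡-Reasoning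

module AutomorphismAction {n : ℕ} (Γ : Graph n) (T : SpanningTree Γ) (Wk : TreeWalks T) (v0 : Fin n)
                          (t : ℕ) (C : Cotree T t) (Al : Aut Γ) (S : Mat t t) (isS : IsSα Wk C v0 Al S) where

  open Graph Γ using (Adj)
  open Cotree C
  open Aut Al
  open CycleCoordinates Γ T Wk v0 t C

  αWalk : ∀ {x y} → Walk Adj x y → Walk Adj (α x) (α y)
  αWalk = mapW α pres

  cnt-αWalk : ∀ {x y} (w : Walk Adj x y) a b → cnt (αWalk w) a b ≡ cnt w (α⁻¹ a) (α⁻¹ b)
  cnt-αWalk = cnt-mapW {R = Adj} α α⁻¹ inv₂ inv₁ pres

  coord-αWalk : ∀ {x} (w : Walk Adj x x) l → coord (αWalk w) l ≡ (coord w ⊙ S) l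
  coord-αWalk w l = begin
    cnt (αWalk w) (u l) (v l)                         ≡⟨ cnt-αWalk w (u l) (v l) ⟩
    cnt w (α⁻¹ (u l)) (α⁻¹ (v l))                     ≡⟨ cnt-closed-in-basis w _ _ ⟩
    Σℤ t (λ i → coord w i * cnt (Lᵢ i) (α⁻¹ (u l)) (α⁻¹ (v l)))
      ≡⟨ Σ-cong t (λ i → cong (coord w i *_) (sym (cnt-αWalk (Lᵢ i) (u l) (v l)))) ⟩
    Σℤ t (λ i → coord w i * cnt (αWalk (Lᵢ i)) (u l) (v l))
      ≡⟨ Σ-cong t (λ i → cong (coord w i *_) (isS i (u l) (v l))) ⟩
    Σℤ t (λ i → coord w i * Σℤ t (λ j → S i j * coord (Lᵢ j) l))
      ≡⟨ Σ-cong t (λ i → cong (coord w i *_) (trans (Σ-cong t (λ j → cong (S i j *_) (coord-L j l))) (⊙-δ (S i) l))) ⟩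
    (coord w ⊙ S) l ∎
    where open ≡-Reasoning

  iterα iterα⁻¹ : ℕ → Fin n → Fin n
  iterα zero    x = x
  iterα (suc k) x = α (iterα k x)
  iterα⁻¹ zero    x = x
  iterα⁻¹ (suc k) x = iterα⁻¹ k (α⁻¹ x)

  iterα-iterα⁻¹ : ∀ k x → iterα k (iterα⁻¹ k x) ≡ x
  iterα-iterα⁻¹ zero    x = refl
  iterα-iterα⁻¹ (suc k) x = trans (cong α (iterα-iterα⁻¹ k (α⁻¹ x))) (inv₁ x)

  iterα⁻¹-iterα : ∀ k x → iterα⁻¹ k (iterα k x) ≡ x
  iterα⁻¹-iterα zero    x = refl
  iterα⁻¹-iterα (suc k) x = trans (cong (iterα⁻¹ k) (inv₂ (iterα k x))) (iterα⁻¹-iterα k x)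

  iterα-+ : ∀ a b x → iterα (a ℕ.+ b) x ≡ iterα a (iterα b x)
  iterα-+ zero    b x = refl
  iterα-+ (suc a) b x = cong α (iterα-+ a b x)

  iterα-comm : ∀ a b x → iterα a (iterα b x) ≡ iterα b (iterα a x)
  iterα-comm a b x = trans (sym (iterα-+ a b x)) (trans (cong (λ k → iterα k x) (ℕP.+-comm a b)) (iterα-+ b a x))

  -- Pigeonhole on x, α x, …, αⁿ x.
  period : ∀ x → Σ ℕ λ d → iterα (suc d) x ≡ x
  period x with FP.pigeonhole (ℕP.n<1+n n) (λ i → iterα (toℕ i) x)
  ... | i , j , i<j , e = d , periodic
    where
    d = toℕ j ℕ.∸ suc (toℕ i)
    j≡ : suc d ℕ.+ toℕ i ≡ toℕ j
    j≡ = trans (sym (ℕP.+-suc d (toℕ i))) (ℕP.m∸n+n≡m i<j)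
    e' : iterα (toℕ i) x ≡ iterα (toℕ i) (iterα (suc d) x)
    e' = trans e (trans (cong (λ k → iterα k x) (sym j≡))
                        (trans (iterα-+ (suc d) (toℕ i) x) (iterα-comm (suc d) (toℕ i) x)))
    periodic : iterα (suc d) x ≡ x
    periodic = trans (sym (iterα⁻¹-iterα (toℕ i) (iterα (suc d) x)))
                     (trans (cong (iterα⁻¹ (toℕ i)) (sym e')) (iterα⁻¹-iterα (toℕ i) x))

  iterα-multiple : ∀ d x → iterα d x ≡ x → ∀ m → iterα (m ℕ.* d) x ≡ x
  iterα-multiple d x e zero    = refl
  iterα-multiple d x e (suc m) =
    trans (iterα-+ d (m ℕ.* d) x) (trans (cong (iterα d) (iterα-multiple d x e m)) e)

  periods : List ℕ
  periods = List.tabulate (λ x → suc (proj₁ (period x)))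

  order : ℕ
  order = product periods

  instance
    order≢0 : NonZero order
    order≢0 = product≢0 (AllP.tabulate⁺ {f = λ x → suc (proj₁ (period x))} (λ _ → _))

  iterα-order : ∀ x → iterα order x ≡ x
  iterα-order x with ∈⇒∣product (∈-tabulate⁺ {f = λ x → suc (proj₁ (period x))} x)
  ... | ℕD.divides q e = trans (cong (λ k → iterα k x) e) (iterα-multiple _ x (proj₂ (period x)) q)

  iterα⁻¹-order : ∀ x → iterα⁻¹ order x ≡ x
  iterα⁻¹-order x = trans (sym (iterα-order (iterα⁻¹ order x))) (iterα-iterα⁻¹ order x)

  iterWalk : ∀ k {x y} → Walk Adj x y → Walk Adj (iterα k x) (iterα k y)
  iterWalk zero    w = w
  iterWalk (suc k) w = αWalk (iterWalk k w)

  cnt-iterWalk : ∀ k {x y} (w : Walk Adj x y) a b → cnt (iterWalk k w) a b ≡ cnt w (iterα⁻¹ k a) (iterα⁻¹ k b)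
  cnt-iterWalk zero    w a b = refl
  cnt-iterWalk (suc k) w a b = trans (cnt-αWalk (iterWalk k w) a b) (cnt-iterWalk k w (α⁻¹ a) (α⁻¹ b))

  _⊙S^_ : (Fin t → ℤ) → ℕ → Fin t → ℤ
  c ⊙S^ zero  = c
  c ⊙S^ suc k = (c ⊙S^ k) ⊙ S

  ⊙S^-cong : ∀ k {c c' : Fin t → ℤ} → (∀ l → c l ≡ c' l) → ∀ l → (c ⊙S^ k) l ≡ (c' ⊙S^ k) l
  ⊙S^-cong zero    e l = e l
  ⊙S^-cong (suc k) e l = ⊙-cong S (⊙S^-cong k e) l

  ⊙S^-+ : ∀ k c c' l → ((λ i → c i + c' i) ⊙S^ k) l ≡ (c ⊙S^ k) l + (c' ⊙S^ k) l
  ⊙S^-+ zero    c c' l = refl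
  ⊙S^-+ (suc k) c c' l = trans (⊙-cong S (⊙S^-+ k c c') l) (⊙-+ (c ⊙S^ k) (c' ⊙S^ k) S l)

  ⊙S^-neg : ∀ k c l → ((λ i → - c i) ⊙S^ k) l ≡ - (c ⊙S^ k) l
  ⊙S^-neg zero    c l = refl
  ⊙S^-neg (suc k) c l = trans (⊙-cong S (⊙S^-neg k c) l) (⊙-neg (c ⊙S^ k) S l)

  ⊙S^-suc : ∀ k c l → ((c ⊙ S) ⊙S^ k) l ≡ (c ⊙S^ suc k) l
  ⊙S^-suc zero    c l = refl
  ⊙S^-suc (suc k) c l = ⊙-cong S (⊙S^-suc k c) l

  coord-iterWalk : ∀ k {x} (w : Walk Adj x x) l → coord (iterWalk k w) l ≡ (coord w ⊙S^ k) l
  coord-iterWalk zero    w l = refl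
  coord-iterWalk (suc k) w l = trans (coord-αWalk (iterWalk k w) l) (⊙-cong S (coord-iterWalk k w) l)

  ⊙S^order : ∀ c l → (c ⊙S^ order) l ≡ c l
  ⊙S^order c l = begin
    (c ⊙S^ order) l                       ≡⟨ ⊙S^-cong order (λ l' → sym (coord-realize c l')) l ⟩
    (coord (realize c) ⊙S^ order) l       ≡⟨ coord-iterWalk order (realize c) l ⟨
    coord (iterWalk order (realize c)) l  ≡⟨ cnt-iterWalk order (realize c) (u l) (v l) ⟩
    cnt (realize c) (iterα⁻¹ order (u l)) (iterα⁻¹ order (v l))
                                          ≡⟨ cong₂ (cnt (realize c)) (iterα⁻¹-order (u l)) (iterα⁻¹-order (v l)) ⟩
    coord (realize c) l                   ≡⟨ coord-realize c l ⟩
    c l                                   ∎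
    where open ≡-Reasoning

-- The lifting criterion: α lifts iff S preserves the kernel of φ₊

module LiftingCriterion {n : ℕ} (Γ : Graph n) (T : SpanningTree Γ) (Wk : TreeWalks T) (v0 : Fin n)
                        (t : ℕ) (C : Cotree T t) {a : ℕ} {M : Fin a → ℕ}
                        (V : Voltage Γ a M) (reduced : TReduced T V) (nz : NonZeroModuli M)
                        (N : ℕ) {{N≢0 : NonZero N}} (M∣N : ∀ j → M j ℕD.∣ N)
                        (Al : Aut Γ) (S : Mat t t) (isS : IsSα Wk C v0 Al S) where

  open Graph Γ using (Adj)
  open Cotree C
  open Voltage V
  open Aut Al
  open CycleCoordinates Γ T Wk v0 t C
  open WalkVoltages Γ T Wk v0 t C V reduced
  open AutomorphismAction Γ T Wk v0 t C Al S isS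
  open EltGroup nz

  -- The voltage of the cycle Σ cᵢ Lᵢ.
  φ₊ : (Fin t → ℤ) → Elt a M
  φ₊ c = fromℤ nz (c ⊙ Θ)

  InKernel : (Fin t → ℤ) → Set
  InKernel c = ∀ j → (c ⊙ Θ) j ≡ + 0 [mod M j ]

  PreservesKernel : Set
  PreservesKernel = ∀ c → InKernel c → InKernel (c ⊙ S)

  φ₊-cong : ∀ {c c'} → (∀ i → c i ≡ c' i) → φ₊ c ≡ φ₊ c'
  φ₊-cong e = fromℤ-cong nz (λ j → mod-reflexive (⊙-cong Θ e j))

  φ₊-mod : ∀ {c c'} → c ≋ c' [mod N ] → φ₊ c ≡ φ₊ c'
  φ₊-mod e = fromℤ-cong nz λ j → ⊙-modˡ Θ (λ i → mod-weaken (ℕD._∣_.quotient (M∣N j))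
                                                  (subst (_ ≡ _ [mod_]) (ℕD._∣_.equality (M∣N j)) (e i))) j

  φ₊-+ : ∀ c c' → φ₊ (λ i → c i + c' i) ≡ addE (φ₊ c) (φ₊ c')
  φ₊-+ c c' = trans (fromℤ-cong nz (λ j → mod-reflexive (⊙-+ c c' Θ j))) (sym (addE-fromℤ nz (c ⊙ Θ) (c' ⊙ Θ)))

  φ₊-neg : ∀ c → φ₊ (λ i → - c i) ≡ negE (φ₊ c)
  φ₊-neg c = trans (fromℤ-cong nz (λ j → mod-reflexive (⊙-neg c Θ j))) (sym (negE-fromℤ nz (c ⊙ Θ)))

  φ₊-0 : φ₊ 0ᵥ ≡ 0E
  φ₊-0 = fromℤ-cong nz (λ j → mod-reflexive (Σ-0 t _ (λ i → ℤP.*-zeroˡ (Θ i j))))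

  InKernel-cong : ∀ {c c'} → (∀ i → c i ≡ c' i) → InKernel c → InKernel c'
  InKernel-cong e z j = mod-trans (mod-reflexive (sym (⊙-cong Θ e j))) (z j)

  φ₊≡0⇒InKernel : ∀ c → φ₊ c ≡ 0E → InKernel c
  φ₊≡0⇒InKernel c = fromℤ-injective nz

  InKernel⇒φ₊≡0 : ∀ c → InKernel c → φ₊ c ≡ 0E
  InKernel⇒φ₊≡0 c = fromℤ-cong nz

  diff : (Fin t → ℤ) → (Fin t → ℤ) → Fin t → ℤ
  diff c c' i = c i - c' i

  ⊙-diff : ∀ c c' j → (diff c c' ⊙ Θ) j ≡ (c ⊙ Θ) j - (c' ⊙ Θ) j
  ⊙-diff c c' j = trans (⊙-+ c (λ i → - c' i) Θ j) (cong (λ s → (c ⊙ Θ) j + s) (⊙-neg c' Θ j))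

  φ₊≡⇒InKernel-diff : ∀ c c' → φ₊ c ≡ φ₊ c' → InKernel (diff c c')
  φ₊≡⇒InKernel-diff c c' e j =
    mod-trans (mod-reflexive (⊙-diff c c' j))
              (mod-trans (mod-+ (fromℤ-injective nz e j) (mod-refl (- (c' ⊙ Θ) j)))
                         (mod-reflexive (ℤP.+-inverseʳ ((c' ⊙ Θ) j))))

  InKernel-diff⇒φ₊≡ : ∀ c c' → InKernel (diff c c') → φ₊ c ≡ φ₊ c'
  InKernel-diff⇒φ₊≡ c c' z = fromℤ-cong nz λ j →
    mod-trans (mod-reflexive (regroup ((c ⊙ Θ) j) ((c' ⊙ Θ) j)))
              (mod-trans (mod-+ (mod-trans (mod-reflexive (sym (⊙-diff c c' j))) (z j)) (mod-refl ((c' ⊙ Θ) j)))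
                         (mod-reflexive (ℤP.+-identityˡ _)))
    where
    regroup : ∀ x y → x ≡ (x - y) + y
    regroup = solve-∀

  voltage : ∀ {x y} → Walk Adj x y → Elt a M
  voltage w = fromℤ nz (volℤ V w)

  voltage≡φ₊ : ∀ {x y} (w : Walk Adj x y) → voltage w ≡ φ₊ (coord w)
  voltage≡φ₊ w = fromℤ-cong nz (volℤ-in-basis w)

  voltage-cons : ∀ {x y z} (r : Adj x y) (w : Walk Adj y z) → voltage (cons r w) ≡ addE (φ x y) (voltage w)
  voltage-cons {x} {y} r w = ι-injective λ j →
    mod-trans (ι-fromℤ nz _ j)
              (mod-sym (mod-trans (ι-addE (φ x y) (voltage w) j) (mod-+ (mod-refl (ι (φ x y) j)) (ι-fromℤ nz (volℤ V w) j))))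

  φ≡φ₊ : ∀ {x y} (r : Adj x y) → φ x y ≡ φ₊ (coord (cons r (nil y)))
  φ≡φ₊ {x} {y} r = trans (sym (addE-identityʳ (φ x y))) (trans (sym (voltage-cons r (nil y))) (voltage≡φ₊ (cons r (nil y))))

  module Necessity (F : Fin n × Elt a M → Fin n × Elt a M)
                   (F-adj : ∀ z z' → DAdj V z z' → DAdj V (F z) (F z'))
                   (F-covers : ∀ z → proj₁ (F z) ≡ α (proj₁ z)) where

    fibre : Fin n → Elt a M → Elt a M
    fibre x g = proj₂ (F (x , g))

    fibre-walk : ∀ {x y} (w : Walk Adj x y) g → fibre y (addE (voltage w) g) ≡ addE (voltage (αWalk w)) (fibre x g)
    fibre-walk (nil x) g = trans (cong (fibre x) (addE-identityˡ g)) (sym (addE-identityˡ _))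
    fibre-walk {x} {y} (cons {y = z} r w) g = begin
      fibre y (addE (voltage (cons r w)) g)               ≡⟨ cong (fibre y) (step (voltage-cons r w)) ⟩
      fibre y (addE (voltage w) g₁)                       ≡⟨ fibre-walk w g₁ ⟩
      addE (voltage (αWalk w)) (fibre z g₁)               ≡⟨ cong (addE (voltage (αWalk w))) lifted-arc ⟩
      addE (voltage (αWalk w)) (addE (φ (α x) (α z)) g')  ≡⟨ step (voltage-cons (pres r) (αWalk w)) ⟨
      addE (voltage (αWalk (cons r w))) g'                ∎
      where
      open ≡-Reasoning
      g₁ = addE (φ x z) g
      g' = fibre x g
      step : ∀ {e v h k} → e ≡ addE h k → addE e v ≡ addE k (addE h v)
      step {v = v} {h} {k} refl = trans (cong (λ s → addE s v) (addE-comm h k)) (addE-assoc k h v)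
      lifted-arc : fibre z g₁ ≡ addE (φ (α x) (α z)) g'
      lifted-arc = trans (proj₂ (F-adj (x , g) (z , g₁) (r , refl)))
                         (cong₂ (λ p q → addE (φ p q) g') (F-covers (x , g)) (F-covers (z , g₁)))

    voltage-αWalk≡0 : ∀ (w : Walk Adj v0 v0) → voltage w ≡ 0E → voltage (αWalk w) ≡ 0E
    voltage-αWalk≡0 w e = sym (addE-cancelʳ 0E (voltage (αWalk w)) (fibre v0 0E) (begin
      addE 0E (fibre v0 0E)                      ≡⟨ addE-identityˡ _ ⟩
      fibre v0 0E                                ≡⟨ cong (fibre v0) (trans (addE-identityʳ (voltage w)) e) ⟨
      fibre v0 (addE (voltage w) 0E)             ≡⟨ fibre-walk w 0E ⟩
      addE (voltage (αWalk w)) (fibre v0 0E)     ∎))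
      where open ≡-Reasoning

    preservesKernel : PreservesKernel
    preservesKernel c z = InKernel-cong (⊙-cong S (coord-realize c)) (φ₊≡0⇒InKernel (coord w ⊙ S) (begin
      φ₊ (coord w ⊙ S)       ≡⟨ φ₊-cong (coord-αWalk w) ⟨
      φ₊ (coord (αWalk w))   ≡⟨ voltage≡φ₊ (αWalk w) ⟨
      voltage (αWalk w)      ≡⟨ voltage-αWalk≡0 w (trans (voltage≡φ₊ w) (trans (φ₊-cong (coord-realize c)) (InKernel⇒φ₊≡0 c z))) ⟩
      0E                     ∎))
      where
      open ≡-Reasoning
      w = realize c

  lifts⇒preservesKernel : Lifts V Al → PreservesKernel
  lifts⇒preservesKernel (F , _ , _ , _ , adj , covers) = Necessity.preservesKernel F (λ z z' → proj₁ (adj z z')) covers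

  InImage : Elt a M → Set
  InImage h = Σ (Fin t → ℤ) λ c → φ₊ c ≡ h

  InImage-0 : InImage 0E
  InImage-0 = 0ᵥ , φ₊-0

  InImage-+ : ∀ {g h} → InImage g → InImage h → InImage (addE g h)
  InImage-+ (c , refl) (c' , refl) = (λ i → c i + c' i) , φ₊-+ c c'

  InImage-neg : ∀ {g} → InImage g → InImage (negE g)
  InImage-neg (c , refl) = (λ i → - c i) , φ₊-neg c

  N-moduli : NonZeroModuli {t} (λ _ → N)
  N-moduli _ = N≢0

  -- The image of φ₊ is already the image of the finitely many coefficient vectors mod N.
  solves : Elt a M → Elt t (λ _ → N) → Bool
  solves h e = does (φ₊ (ι e) ≟E h)

  inImage? : Elt a M → Bool
  inImage? h = Maybe.is-just (search (solves h))

  search-solves : ∀ h → InImage h → Σ (Elt t (λ _ → N)) λ e → search (solves h) ≡ just e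
  search-solves h (c , e) = search-complete (solves h) (fromℤ N-moduli c)
    (dec-true (φ₊ (ι (fromℤ N-moduli c)) ≟E h) (trans (φ₊-mod (ι-fromℤ N-moduli c)) e))

  inImage?-complete : ∀ h → InImage h → inImage? h ≡ true
  inImage?-complete h ce = is-just-just (proj₂ (search-solves h ce))

  inImage?-sound : ∀ h → inImage? h ≡ true → InImage h
  inImage?-sound h q with is-just⇒just (search (solves h)) q
  ... | e , found = ι e , does-true (φ₊ (ι e) ≟E h) (search-sound (solves h) found)

  representative : Elt a M → Elt a M
  representative g = Maybe.fromMaybe 0E (search (λ e → inImage? (addE g (negE e))))

  representative-spec : ∀ g → InImage (addE g (negE (representative g)))
  representative-spec g with search-complete (λ e → inImage? (addE g (negE e))) g
                                (inImage?-complete _ (subst InImage (sym (addE-inverseʳ g)) InImage-0))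
  ... | e , found = subst (λ r → InImage (addE g (negE r))) (sym (cong (Maybe.fromMaybe 0E) found))
                          (inImage?-sound _ (search-sound (λ e → inImage? (addE g (negE e))) found))

  representative-cong : ∀ g g' → InImage (addE g (negE g')) → representative g ≡ representative g'
  representative-cong g g' d = cong (Maybe.fromMaybe 0E) (search-cong λ e → bool-ext
    (λ q → inImage?-complete _ (subst InImage (sub-sub-cancel g g' e)
                                      (InImage-+ (InImage-neg d) (inImage?-sound (addE g (negE e)) q))))
    (λ q → inImage?-complete _ (subst InImage (sub-sub-cancel g' g e)
                                      (InImage-+ (subst InImage (sym (negE-sub g' g)) d) (inImage?-sound (addE g' (negE e)) q)))))

  module InducedMap (Tr : (Fin t → ℤ) → Fin t → ℤ)
                    (Tr-+ : ∀ c c' l → Tr (λ i → c i + c' i) l ≡ Tr c l + Tr c' l)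
                    (Tr-neg : ∀ c l → Tr (λ i → - c i) l ≡ - Tr c l)
                    (Tr-kernel : ∀ c → InKernel c → InKernel (Tr c)) where

    induced : Elt a M → Elt a M
    induced h = Maybe.maybe (λ e → φ₊ (Tr (ι e))) 0E (search (solves h))

    Tr-φ₊ : ∀ c c' → φ₊ c ≡ φ₊ c' → φ₊ (Tr c) ≡ φ₊ (Tr c')
    Tr-φ₊ c c' e = InKernel-diff⇒φ₊≡ (Tr c) (Tr c')
      (InKernel-cong (λ l → trans (Tr-+ c (λ i → - c' i) l) (cong (λ s → Tr c l + s) (Tr-neg c' l)))
                     (Tr-kernel _ (φ₊≡⇒InKernel-diff c c' e)))

    induced-φ₊ : ∀ c → induced (φ₊ c) ≡ φ₊ (Tr c)
    induced-φ₊ c with search-solves (φ₊ c) (c , refl)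
    ... | e , found = trans (cong (Maybe.maybe (λ e → φ₊ (Tr (ι e))) 0E) found)
                            (Tr-φ₊ (ι e) c (does-true (φ₊ (ι e) ≟E φ₊ c) (search-sound (solves (φ₊ c)) found)))

    induced-image : ∀ {h} → InImage h → InImage (induced h)
    induced-image (c , refl) = Tr c , sym (induced-φ₊ c)

    induced-+ : ∀ c c' → induced (φ₊ (λ i → c i + c' i)) ≡ addE (induced (φ₊ c)) (induced (φ₊ c'))
    induced-+ c c' = trans (induced-φ₊ _) (trans (φ₊-cong (Tr-+ c c')) (trans (φ₊-+ (Tr c) (Tr c'))
                           (sym (cong₂ addE (induced-φ₊ c) (induced-φ₊ c')))))

  module Sufficiency (preserves : PreservesKernel) where

    ⊙S^-kernel : ∀ k c → InKernel c → InKernel (c ⊙S^ k)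
    ⊙S^-kernel zero    c z = z
    ⊙S^-kernel (suc k) c z = preserves (c ⊙S^ k) (⊙S^-kernel k c z)

    -- S has finite order, so S^(order - 1) inverts S on the image of φ₊.
    k⁻¹ : ℕ
    k⁻¹ = ℕ.pred order

    ⊙S^suc-k⁻¹ : ∀ c l → (c ⊙S^ suc k⁻¹) l ≡ c l
    ⊙S^suc-k⁻¹ c l = trans (cong (λ k → (c ⊙S^ k) l) (ℕP.suc-pred order)) (⊙S^order c l)

    open InducedMap (_⊙ S) (λ c c' → ⊙-+ c c' S) (λ c → ⊙-neg c S) preserves
      renaming (induced to f; induced-φ₊ to f-φ₊; induced-image to f-image; induced-+ to f-+)
    open InducedMap (_⊙S^ k⁻¹) (⊙S^-+ k⁻¹) (⊙S^-neg k⁻¹) (⊙S^-kernel k⁻¹)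
      renaming (induced to f⁻¹; induced-φ₊ to f⁻¹-φ₊; induced-image to f⁻¹-image)

    f⁻¹-f : ∀ {h} → InImage h → f⁻¹ (f h) ≡ h
    f⁻¹-f (c , refl) =
      trans (cong f⁻¹ (f-φ₊ c)) (trans (f⁻¹-φ₊ (c ⊙ S)) (φ₊-cong (λ l → trans (⊙S^-suc k⁻¹ c l) (⊙S^suc-k⁻¹ c l))))

    f-f⁻¹ : ∀ {h} → InImage h → f (f⁻¹ h) ≡ h
    f-f⁻¹ (c , refl) = trans (cong f (f⁻¹-φ₊ c)) (trans (f-φ₊ (c ⊙S^ k⁻¹)) (φ₊-cong (⊙S^suc-k⁻¹ c)))

    offset : Elt a M → Elt a M
    offset g = addE g (negE (representative g))

    -- Extend an automorphism of im φ₊ to all of A, fixing every coset representative.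
    extendBy : (Elt a M → Elt a M) → Elt a M → Elt a M
    extendBy f g = addE (f (offset g)) (representative g)

    representative-extendBy : ∀ (f : Elt a M → Elt a M) → (∀ {h} → InImage h → InImage (f h)) →
                              ∀ g → representative (extendBy f g) ≡ representative g
    representative-extendBy f f-image g =
      representative-cong (extendBy f g) g
        (subst InImage (sym (add-sub-assoc (f (offset g)) (representative g) g))
               (InImage-+ (f-image (representative-spec g)) (InImage-neg (representative-spec g))))

    extendBy-inverse : ∀ (f f' : Elt a M → Elt a M) → (∀ {h} → InImage h → InImage (f h)) →
                       (∀ {h} → InImage h → f' (f h) ≡ h) → ∀ g → extendBy f' (extendBy f g) ≡ g
    extendBy-inverse f f' f-image f'-f g = begin
      addE (f' (offset (extendBy f g))) (representative (extendBy f g))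
        ≡⟨ cong (λ r → addE (f' (addE (extendBy f g) (negE r))) r) (representative-extendBy f f-image g) ⟩
      addE (f' (addE (extendBy f g) (negE (representative g)))) (representative g)
        ≡⟨ cong (λ x → addE (f' x) (representative g)) (add-sub _ _) ⟩
      addE (f' (f (offset g))) (representative g)
        ≡⟨ cong (λ x → addE x (representative g)) (f'-f (representative-spec g)) ⟩
      addE (offset g) (representative g)
        ≡⟨ sub-add g (representative g) ⟩
      g ∎
      where open ≡-Reasoning

    extend extend⁻¹ : Elt a M → Elt a M
    extend   = extendBy f
    extend⁻¹ = extendBy f⁻¹

    extend-translate : ∀ c g → extend (addE (φ₊ c) g) ≡ addE (φ₊ (c ⊙ S)) (extend g)
    extend-translate c g = begin
      addE (f (addE g' (negE (representative g')))) (representative g')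
        ≡⟨ cong (λ r → addE (f (addE g' (negE r))) r) same-rep ⟩
      addE (f (addE g' (negE (representative g)))) (representative g)
        ≡⟨ cong (λ x → addE (f x) (representative g)) (addE-assoc (φ₊ c) g _) ⟩
      addE (f (addE (φ₊ c) (offset g))) (representative g)
        ≡⟨ cong (λ x → addE (f (addE (φ₊ c) x)) (representative g)) (proj₂ (representative-spec g)) ⟨
      addE (f (addE (φ₊ c) (φ₊ cg))) (representative g)
        ≡⟨ cong (λ x → addE (f x) (representative g)) (φ₊-+ c cg) ⟨
      addE (f (φ₊ (λ i → c i + cg i))) (representative g)
        ≡⟨ cong (λ x → addE x (representative g)) (f-+ c cg) ⟩
      addE (addE (f (φ₊ c)) (f (φ₊ cg))) (representative g)
        ≡⟨ addE-assoc _ _ _ ⟩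
      addE (f (φ₊ c)) (addE (f (φ₊ cg)) (representative g))
        ≡⟨ cong₂ (λ x y → addE x (addE (f y) (representative g))) (f-φ₊ c) (proj₂ (representative-spec g)) ⟩
      addE (φ₊ (c ⊙ S)) (extend g) ∎
      where
      open ≡-Reasoning
      g' = addE (φ₊ c) g
      cg = proj₁ (representative-spec g)
      same-rep : representative g' ≡ representative g
      same-rep = representative-cong g' g (c , sym (add-sub (φ₊ c) g))

    ρc : Fin n → Fin t → ℤ
    ρc x = coord (αWalk (treePath v0 x))

    ρ : Fin n → Elt a M
    ρ x = φ₊ (ρc x)

    coord-αWalk-back : ∀ y l → coord (αWalk (treePath y v0)) l + ρc y l ≡ + 0
    coord-αWalk-back y l = begin
      coord (αWalk (treePath y v0)) l + ρc y l
        ≡⟨ cnt-++ (αWalk (treePath y v0)) (αWalk (treePath v0 y)) (u l) (v l) ⟨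
      coord (αWalk (treePath y v0) ++ αWalk (treePath v0 y)) l
        ≡⟨ cong (λ w → coord w l) (mapW-++ α pres (treePath y v0) (treePath v0 y)) ⟨
      coord (αWalk (treePath y v0 ++ treePath v0 y)) l
        ≡⟨ coord-αWalk (treePath y v0 ++ treePath v0 y) l ⟩
      (coord (treePath y v0 ++ treePath v0 y) ⊙ S) l
        ≡⟨ Σ-0 t _ (λ i → trans (cong (_* S i l) (trans (cnt-++ (treePath y v0) (treePath v0 y) (u i) (v i))
                                                        (cong₂ _+_ (coord-treePath y v0 i) (coord-treePath v0 y i))))
                                (ℤP.*-zeroˡ (S i l))) ⟩
      + 0 ∎
      where open ≡-Reasoning

    coord-αWalk-closedWalk : ∀ {x y} (r : Adj x y) l →
      coord (αWalk (closedWalk r)) l ≡ ρc x l + (arcCoord (α x) (α y) l + coord (αWalk (treePath y v0)) l)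
    coord-αWalk-closedWalk {x} {y} r l = begin
      coord (αWalk (closedWalk r)) l
        ≡⟨ cong (λ w → coord w l) (mapW-++ α pres (treePath v0 x) (cons r (treePath y v0))) ⟩
      coord (αWalk (treePath v0 x) ++ cons (pres r) (αWalk (treePath y v0))) l
        ≡⟨ cnt-++ (αWalk (treePath v0 x)) (cons (pres r) (αWalk (treePath y v0))) (u l) (v l) ⟩
      ρc x l + coord (cons (pres r) (αWalk (treePath y v0))) l
        ≡⟨ cong (λ v → ρc x l + v) (cnt-cons {R = Adj} (pres r) (αWalk (treePath y v0)) (u l) (v l)) ⟩
      ρc x l + (arcCoord (α x) (α y) l + coord (αWalk (treePath y v0)) l) ∎
      where open ≡-Reasoning

    -- Push the closed walk through x → y forward by α and compare coordinates.
    φ₊-arc-α : ∀ {x y} (r : Adj x y) → addE (φ₊ (coord (cons r (nil y)) ⊙ S)) (ρ y) ≡ addE (ρ x) (φ (α x) (α y))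
    φ₊-arc-α {x} {y} r = begin
      addE (φ₊ (c ⊙ S)) (ρ y)                    ≡⟨ φ₊-+ (c ⊙ S) (ρc y) ⟨
      φ₊ (λ l → (c ⊙ S) l + ρc y l)              ≡⟨ φ₊-cong coords ⟩
      φ₊ (λ l → ρc x l + coord arc l)            ≡⟨ φ₊-+ (ρc x) (coord arc) ⟩
      addE (ρ x) (φ₊ (coord arc))                ≡⟨ cong (addE (ρ x)) (φ≡φ₊ (pres r)) ⟨
      addE (ρ x) (φ (α x) (α y))                 ∎
      where
      open ≡-Reasoning
      c = coord (cons r (nil y))
      arc = cons (pres r) (nil (α y))
      coord-arc : ∀ l → arcCoord (α x) (α y) l ≡ coord arc l
      coord-arc l = trans (sym (ℤP.+-identityʳ _)) (sym (cnt-cons {R = Adj} (pres r) (nil (α y)) (u l) (v l)))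
      regroup : ∀ p q r s → p + (q + r) + s ≡ p + q + (r + s)
      regroup = solve-∀
      coords : ∀ l → (c ⊙ S) l + ρc y l ≡ ρc x l + coord arc l
      coords l = begin
        (c ⊙ S) l + ρc y l
          ≡⟨ cong (_+ ρc y l) (trans (⊙-cong S (λ i → sym (coord-closedWalk r i)) l) (sym (coord-αWalk (closedWalk r) l))) ⟩
        coord (αWalk (closedWalk r)) l + ρc y l
          ≡⟨ cong (_+ ρc y l) (coord-αWalk-closedWalk r l) ⟩
        ρc x l + (arcCoord (α x) (α y) l + coord (αWalk (treePath y v0)) l) + ρc y l
          ≡⟨ regroup (ρc x l) _ _ (ρc y l) ⟩
        ρc x l + arcCoord (α x) (α y) l + (coord (αWalk (treePath y v0)) l + ρc y l)
          ≡⟨ cong₂ (λ q s → ρc x l + q + s) (coord-arc l) (coord-αWalk-back y l) ⟩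
        ρc x l + coord arc l + + 0
          ≡⟨ ℤP.+-identityʳ _ ⟩
        ρc x l + coord arc l ∎

    extend-arc : ∀ {x y} (r : Adj x y) g →
                 addE (extend (addE (φ x y) g)) (ρ y) ≡ addE (φ (α x) (α y)) (addE (extend g) (ρ x))
    extend-arc {x} {y} r g = begin
      addE (extend (addE (φ x y) g)) (ρ y)     ≡⟨ cong (λ h → addE (extend (addE h g)) (ρ y)) (φ≡φ₊ r) ⟩
      addE (extend (addE (φ₊ c) g)) (ρ y)      ≡⟨ cong (λ h → addE h (ρ y)) (extend-translate c g) ⟩
      addE (addE (φ₊ (c ⊙ S)) e) (ρ y)         ≡⟨ cong (λ h → addE h (ρ y)) (addE-comm (φ₊ (c ⊙ S)) e) ⟩
      addE (addE e (φ₊ (c ⊙ S))) (ρ y)         ≡⟨ addE-assoc e _ (ρ y) ⟩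
      addE e (addE (φ₊ (c ⊙ S)) (ρ y))         ≡⟨ cong (addE e) (φ₊-arc-α r) ⟩
      addE e (addE (ρ x) φ')                   ≡⟨ cong (addE e) (addE-comm (ρ x) φ') ⟩
      addE e (addE φ' (ρ x))                   ≡⟨ addE-assoc e φ' (ρ x) ⟨
      addE (addE e φ') (ρ x)                   ≡⟨ cong (λ h → addE h (ρ x)) (addE-comm e φ') ⟩
      addE (addE φ' e) (ρ x)                   ≡⟨ addE-assoc φ' e (ρ x) ⟩
      addE φ' (addE e (ρ x))                   ∎
      where
      open ≡-Reasoning
      c = coord (cons r (nil y))
      e = extend g
      φ' = φ (α x) (α y)

    extend⁻¹-extend : ∀ g → extend⁻¹ (extend g) ≡ g
    extend⁻¹-extend = extendBy-inverse f f⁻¹ f-image f⁻¹-f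

    extend-extend⁻¹ : ∀ g → extend (extend⁻¹ g) ≡ g
    extend-extend⁻¹ = extendBy-inverse f⁻¹ f f⁻¹-image f-f⁻¹

    lift lift⁻¹ : Fin n × Elt a M → Fin n × Elt a M
    lift   (x , g) = α x , addE (extend g) (ρ x)
    lift⁻¹ (y , g) = α⁻¹ y , extend⁻¹ (addE g (negE (ρ (α⁻¹ y))))

    lift-lift⁻¹ : ∀ z → lift (lift⁻¹ z) ≡ z
    lift-lift⁻¹ (y , g) =
      cong₂ _,_ (inv₁ y) (trans (cong (λ h → addE h (ρ (α⁻¹ y))) (extend-extend⁻¹ _)) (sub-add g _))

    lift⁻¹-lift : ∀ z → lift⁻¹ (lift z) ≡ z
    lift⁻¹-lift (x , g) = cong₂ _,_ (inv₂ x) (begin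
      extend⁻¹ (addE (addE (extend g) (ρ x)) (negE (ρ (α⁻¹ (α x)))))
        ≡⟨ cong (λ y → extend⁻¹ (addE (addE (extend g) (ρ x)) (negE (ρ y)))) (inv₂ x) ⟩
      extend⁻¹ (addE (addE (extend g) (ρ x)) (negE (ρ x)))
        ≡⟨ cong extend⁻¹ (add-sub (extend g) (ρ x)) ⟩
      extend⁻¹ (extend g)
        ≡⟨ extend⁻¹-extend g ⟩
      g ∎)
      where open ≡-Reasoning

    lift-adj : ∀ z z' → DAdj V z z' → DAdj V (lift z) (lift z')
    lift-adj (x , g) (y , h) (r , refl) = pres r , extend-arc r g

    lift-adj⁻ : ∀ z z' → DAdj V (lift z) (lift z') → DAdj V z z'
    lift-adj⁻ (x , g) (y , h) (r' , e) = r , (begin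
      h                               ≡⟨ extend⁻¹-extend h ⟨
      extend⁻¹ (extend h)             ≡⟨ cong extend⁻¹ (addE-cancelʳ _ _ (ρ y) (trans e (sym (extend-arc r g)))) ⟩
      extend⁻¹ (extend (addE (φ x y) g)) ≡⟨ extend⁻¹-extend _ ⟩
      addE (φ x y) g                  ∎)
      where
      open ≡-Reasoning
      r = refl' r'

    lifts : Lifts V Al
    lifts = lift , lift⁻¹ , lift-lift⁻¹ , lift⁻¹-lift , (λ z z' → lift-adj z z' , lift-adj⁻ z z') , (λ _ → refl)

  preservesKernel⇒lifts : PreservesKernel → Lifts V Al
  preservesKernel⇒lifts = Sufficiency.lifts

module _ (p : ℕ) where

  dp-∣ : ∀ r c → (p ^ dp p r c) ℕD.∣ ℤ.∣ c ∣
  dp-∣ zero    c = ℕD.1∣ _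
  dp-∣ (suc r) c with (p ^ suc r) ℕD.∣? ℤ.∣ c ∣
  ... | yes d = d
  ... | no _  = dp-∣ r c

  ∣⇒≤dp : ∀ k r c → r ≤ k → (p ^ r) ℕD.∣ ℤ.∣ c ∣ → r ≤ dp p k c
  ∣⇒≤dp zero    .zero c z≤n d = z≤n
  ∣⇒≤dp (suc k) r c r≤k d with (p ^ suc k) ℕD.∣? ℤ.∣ c ∣
  ... | yes _ = r≤k
  ... | no ¬d with ℕP.m≤n⇒m<n∨m≡n r≤k
  ...   | inj₂ refl        = ⊥-elim (¬d d)
  ...   | inj₁ (s≤s r≤k-1) = ∣⇒≤dp k r c r≤k-1 d

  ^-split : ∀ x y → x ≤ y → p ^ y ≡ p ^ x ℕ.* p ^ (y ∸ x)
  ^-split x y x≤y = trans (cong (p ^_) (sym (ℕP.m+[n∸m]≡n x≤y))) (ℕP.^-distribˡ-+-* p x (y ∸ x))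

  ^-∣ : ∀ x y → x ≤ y → (p ^ x) ℕD.∣ (p ^ y)
  ^-∣ x y x≤y = ℕD.divides (p ^ (y ∸ x)) (trans (^-split x y x≤y) (ℕP.*-comm (p ^ x) _))

  +^ : ℕ → ℤ
  +^ x = + (p ^ x)

  +^-split : ∀ x y → x ≤ y → +^ y ≡ +^ x * +^ (y ∸ x)
  +^-split x y x≤y = trans (cong +_ (^-split x y x≤y)) (ℤP.pos-* (p ^ x) (p ^ (y ∸ x)))

  ^-suc : .{{NonZero p}} → ∀ x → Σ ℕ λ d → p ^ x ≡ suc d
  ^-suc x with p ^ x | ℕP.m^n≢0 p x
  ... | suc d | _ = d , refl

-- Matrices preserving the kernel of diag(p^{s₁}, …, p^{sₜ}) over ℤ/p^k

module DiagonalKernel (p k : ℕ) {{p≢0 : NonZero p}} {t : ℕ} (s : Fin t → ℕ)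
                      (s≤k : ∀ i → s i ≤ k) (s-mono : ∀ i j → toℕ i ≤ toℕ j → s i ≤ s j) where

  InKernel⁰ : (Fin t → ℤ) → Set
  InKernel⁰ y = ∀ l → y l * +^ p (s l) ≡ + 0 [mod p ^ k ]

  InKernel⁰-≋ : ∀ {y y'} → y ≋ y' [mod p ^ k ] → InKernel⁰ y → InKernel⁰ y'
  InKernel⁰-≋ e z l = mod-trans (mod-*ʳ (+^ p (s l)) (mod-sym (e l))) (z l)

  Preserves : Mat t t → Set
  Preserves X = ∀ y → InKernel⁰ y → InKernel⁰ (y ⊙ X)

  DegreeCondition : Mat t t → Set
  DegreeCondition X = ∀ i j → toℕ j < toℕ i → s i ∸ s j ≤ dp p k (X i j)

  module DegreeBound (X : Mat t t) (preserves : Preserves X) (i j : Fin t) (sj<si : s j < s i) where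

    P : ℤ
    P = +^ p (k ∸ s i)

    P*p^si : P * +^ p (s i) ≡ + (p ^ k)
    P*p^si = trans (ℤP.*-comm P (+^ p (s i))) (sym (+^-split p (s i) k (s≤k i)))

    y : Fin t → ℤ
    y m = δ m i * P

    y-kernel : InKernel⁰ y
    y-kernel m with m F.≟ i
    ... | yes refl = mod-trans (mod-reflexive (trans (cong (λ d → d * P * +^ p (s m)) (δ-refl m))
                                                     (trans (cong (_* +^ p (s m)) (ℤP.*-identityˡ P)) P*p^si)))
                               (mod-trans (mod-reflexive (sym (ℤP.*-identityˡ _))) (multiple≡0 (+ 1)))
    ... | no m≢i = mod-reflexive (trans (cong (λ d → d * P * +^ p (s m)) (δ-distinct m i m≢i))
                                        (trans (cong (_* +^ p (s m)) (ℤP.*-zeroˡ P)) (ℤP.*-zeroˡ (+^ p (s m)))))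

    y⊙X : ∀ m → (y ⊙ X) m ≡ P * X i m
    y⊙X m = trans (Σ-cong t (λ l → trans (ℤP.*-assoc (δ l i) P (X l m)) (ℤP.*-comm (δ l i) (P * X l m))))
                  (Σ-δʳ t i (λ l → P * X l m))

    e d : ℕ
    e = k ∸ s i ℕ.+ s j
    d = s i ∸ s j

    k≡e+d : k ≡ e ℕ.+ d
    k≡e+d = sym (trans (ℕP.+-assoc (k ∸ s i) (s j) d)
                       (trans (cong (k ∸ s i ℕ.+_) (ℕP.m+[n∸m]≡n (ℕP.<⇒≤ sj<si))) (ℕP.m∸n+n≡m (s≤k i))))

    p^d∣Xij : X i j ≡ + 0 [mod p ^ d ]
    p^d∣Xij with ^-suc p e
    ... | e' , p^e≡ = mod-cancel e' (subst (λ E → + E * X i j ≡ + 0 [mod E ℕ.* p ^ d ]) p^e≡ scaled)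
      where
      regroup : ∀ a b c → a * b * c ≡ a * c * b
      regroup = solve-∀
      scaled : +^ p e * X i j ≡ + 0 [mod p ^ e ℕ.* p ^ d ]
      scaled = subst (λ K → +^ p e * X i j ≡ + 0 [mod K ]) (trans (cong (p ^_) k≡e+d) (ℕP.^-distribˡ-+-* p e d))
        (mod-trans (mod-reflexive (trans (cong (_* X i j) (+^-split p (k ∸ s i) e (ℕP.m≤m+n _ _)))
                                         (trans (cong (λ v → P * +^ p v * X i j) (ℕP.m+n∸m≡n (k ∸ s i) (s j)))
                                                (regroup P (+^ p (s j)) (X i j)))))
                   (mod-trans (mod-reflexive (cong (_* +^ p (s j)) (sym (y⊙X j)))) (preserves y y-kernel j)))

  preserves⇒degree : ∀ X → Preserves X → DegreeCondition X
  preserves⇒degree X preserves i j j<i with s i ℕ.≤? s j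
  ... | yes si≤sj = ℕP.≤-trans (ℕP.≤-reflexive (ℕP.m≤n⇒m∸n≡0 si≤sj)) z≤n
  ... | no  si≰sj = ∣⇒≤dp p k (s i ∸ s j) (X i j) (ℕP.≤-trans (ℕP.m∸n≤m (s i) (s j)) (s≤k i))
                            (≡mod0⇒∣ (DegreeBound.p^d∣Xij X preserves i j (ℕP.≰⇒> si≰sj)))

  degree⇒preserves : ∀ X → DegreeCondition X → Preserves X
  degree⇒preserves X degree y z m =
    mod-trans (mod-reflexive (sym (Σ-*ʳ t (+^ p (s m)) (λ l → y l * X l m))))
              (mod-trans (Σ-mod t term) (mod-reflexive (Σ-0 t _ (λ _ → refl))))
    where
    term : ∀ l → y l * X l m * +^ p (s m) ≡ + 0 [mod p ^ k ]
    term l with toℕ m ℕ.<? toℕ l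
    ... | yes m<l = mod-trans (mod-reflexive factor) (mod-trans (mod-*ˡ q (z l)) (mod-reflexive (ℤP.*-zeroʳ q)))
      where
      sm≤sl = s-mono m l (ℕP.<⇒≤ m<l)
      divides : X l m ≡ + 0 [mod p ^ (s l ∸ s m) ]
      divides = ∣⇒≡mod0 (ℕD.∣-trans (^-∣ p (s l ∸ s m) (dp p k (X l m)) (degree l m m<l)) (dp-∣ p k (X l m)))
      q = _≡_[mod_].quotient divides
      regroup : ∀ y q d s → y * (q * d) * s ≡ q * (y * (s * d))
      regroup = solve-∀
      factor : y l * X l m * +^ p (s m) ≡ q * (y l * +^ p (s l))
      factor = begin
        y l * X l m * +^ p (s m)
          ≡⟨ cong (λ x → y l * x * +^ p (s m)) (trans (_≡_[mod_].equation divides) (ℤP.+-identityˡ _)) ⟩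
        y l * (q * +^ p (s l ∸ s m)) * +^ p (s m)
          ≡⟨ regroup (y l) q _ _ ⟩
        q * (y l * (+^ p (s m) * +^ p (s l ∸ s m)))
          ≡⟨ cong (λ x → q * (y l * x)) (+^-split p (s m) (s l) sm≤sl) ⟨
        q * (y l * +^ p (s l)) ∎
        where open ≡-Reasoning
    ... | no m≮l = mod-trans (mod-reflexive factor) (mod-trans (mod-*ʳ rest (z l)) (mod-reflexive (ℤP.*-zeroˡ rest)))
      where
      sl≤sm = s-mono l m (ℕP.≮⇒≥ m≮l)
      rest = X l m * +^ p (s m ∸ s l)
      regroup : ∀ y x a b → y * x * (a * b) ≡ y * a * (x * b)
      regroup = solve-∀
      factor : y l * X l m * +^ p (s m) ≡ y l * +^ p (s l) * rest
      factor = trans (cong (y l * X l m *_) (+^-split p (s l) (s m) sl≤sm)) (regroup (y l) (X l m) _ _)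

-- Reading the kernel of B through its normal form B⁰ = Q B T'

module NormalFormCriterion (p k : ℕ) {{p≢0 : NonZero p}} {t a : ℕ} (B : Mat t a) (S Q Q⁻¹ : Mat t t)
                           (T' T'⁻¹ : Mat a a) (invQ : InverseMod (p ^ k) Q Q⁻¹) (invT : InverseMod (p ^ k) T' T'⁻¹)
                           (s : Fin t → ℕ) (nf : IsNormalForm p k ((Q · B) · T') s) where

  B⁰ : Mat t a
  B⁰ = (Q · B) · T'

  S' : Mat t t
  S' = (Q · S) · Q⁻¹

  B⁰-entry : ∀ i j → B⁰ i j ≡ δ i j * +^ p (s i) [mod p ^ k ]
  B⁰-entry i j = ≡[]⇒≡mod (proj₂ (proj₂ (proj₂ nf)) i j)

  rank : ℕ
  rank = proj₁ (proj₁ (proj₂ nf))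

  rank≤a : rank ≤ a
  rank≤a = proj₁ (proj₂ (proj₂ (proj₁ (proj₂ nf))))

  s<k : ∀ i → toℕ i < rank → s i < k
  s<k = proj₁ (proj₂ (proj₂ (proj₂ (proj₁ (proj₂ nf)))))

  s≡k : ∀ i → rank ≤ toℕ i → s i ≡ k
  s≡k = proj₂ (proj₂ (proj₂ (proj₂ (proj₁ (proj₂ nf)))))

  s-mono : ∀ i j → toℕ i ≤ toℕ j → s i ≤ s j
  s-mono = proj₁ (proj₂ (proj₂ nf))

  s≤k : ∀ i → s i ≤ k
  s≤k i with toℕ i ℕ.<? rank
  ... | yes i<r = ℕP.<⇒≤ (s<k i i<r)
  ... | no  i≮r = ℕP.≤-reflexive (s≡k i (ℕP.≮⇒≥ i≮r))

  open DiagonalKernel p k s s≤k s-mono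

  InKernelB : (Fin t → ℤ) → Set
  InKernelB c = c ⊙ B ≋ 0ᵥ [mod p ^ k ]

  PreservesKernelB : Set
  PreservesKernelB = ∀ c → InKernelB c → InKernelB (c ⊙ S)

  ⊙-cancel : ∀ {m} (X X⁻¹ : Mat m m) → (∀ i j → (X · X⁻¹) i j ≡[ p ^ k ] δ i j) →
             ∀ c → c ⊙ X ⊙ X⁻¹ ≋ c [mod p ^ k ]
  ⊙-cancel X X⁻¹ inv c l =
    mod-trans (mod-reflexive (⊙-assoc c X X⁻¹ l))
              (mod-trans (⊙-modʳ c {X · X⁻¹} {δ} (λ i j → ≡[]⇒≡mod (inv i j)) l) (mod-reflexive (⊙-δ c l)))

  InKernelB-≋ : ∀ {c c'} → c ≋ c' [mod p ^ k ] → InKernelB c → InKernelB c'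
  InKernelB-≋ e z j = mod-trans (⊙-modˡ B (λ l → mod-sym (e l)) j) (z j)

  ⊙Q⁻¹⊙B⁰ : ∀ c → c ⊙ Q⁻¹ ⊙ B⁰ ≋ c ⊙ B ⊙ T' [mod p ^ k ]
  ⊙Q⁻¹⊙B⁰ c j =
    mod-trans (mod-reflexive (sym (⊙-assoc (c ⊙ Q⁻¹) (Q · B) T' j)))
              (⊙-modˡ T' (λ l → mod-trans (mod-reflexive (sym (⊙-assoc (c ⊙ Q⁻¹) Q B l)))
                                           (⊙-modˡ B (⊙-cancel Q⁻¹ Q (proj₂ invQ) c) l)) j)

  ⊙S' : ∀ c → c ⊙ Q⁻¹ ⊙ S' ≋ c ⊙ S ⊙ Q⁻¹ [mod p ^ k ]
  ⊙S' c l =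
    mod-trans (mod-reflexive (trans (sym (⊙-assoc (c ⊙ Q⁻¹) (Q · S) Q⁻¹ l))
                                    (⊙-cong Q⁻¹ (λ l' → sym (⊙-assoc (c ⊙ Q⁻¹) Q S l')) l)))
              (⊙-modˡ Q⁻¹ (⊙-modˡ S (⊙-cancel Q⁻¹ Q (proj₂ invQ) c)) l)

  ⊙B⁰-column : ∀ (y : Fin t → ℤ) (j : Fin t) (j' : Fin a) → toℕ j' ≡ toℕ j →
               (y ⊙ B⁰) j' ≡ y j * +^ p (s j) [mod p ^ k ]
  ⊙B⁰-column y j j' j'≡j =
    mod-trans (⊙-modʳ y {B⁰} {λ m m' → δ m m' * +^ p (s m)} B⁰-entry j')
              (mod-reflexive (trans (Σ-single t _ j off-diagonal) (trans (cong (λ d → y j * (d * +^ p (s j))) (δ-≡ j j' (sym j'≡j)))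
                                                                   (cong (y j *_) (ℤP.*-identityˡ _)))))
    where
    off-diagonal : ∀ m → ¬ m ≡ j → y m * (δ m j' * +^ p (s m)) ≡ + 0
    off-diagonal m m≢j = trans (cong (λ d → y m * (d * +^ p (s m))) (δ-≢ m j' (λ e → m≢j (FP.toℕ-injective (trans e j'≡j)))))
                               (trans (cong (y m *_) (ℤP.*-zeroˡ (+^ p (s m)))) (ℤP.*-zeroʳ (y m)))

  -- Rows beyond the number a of columns have exponent k, so carry no condition.
  ⊙B⁰≋0⇒InKernel⁰ : ∀ y → y ⊙ B⁰ ≋ 0ᵥ [mod p ^ k ] → InKernel⁰ y
  ⊙B⁰≋0⇒InKernel⁰ y z l with toℕ l ℕ.<? a
  ... | yes l<a = mod-trans (mod-sym (⊙B⁰-column y l (F.fromℕ< l<a) (FP.toℕ-fromℕ< l<a))) (z (F.fromℕ< l<a))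
  ... | no  l≮a = subst (λ e → y l * +^ p e ≡ + 0 [mod p ^ k ]) (sym (s≡k l (ℕP.≤-trans rank≤a (ℕP.≮⇒≥ l≮a))))
                        (multiple≡0 (y l))

  InKernel⁰⇒⊙B⁰≋0 : ∀ y → InKernel⁰ y → y ⊙ B⁰ ≋ 0ᵥ [mod p ^ k ]
  InKernel⁰⇒⊙B⁰≋0 y z j' =
    mod-trans (⊙-modʳ y {B⁰} {λ m m' → δ m m' * +^ p (s m)} B⁰-entry j')
              (mod-trans (Σ-mod t (λ m → mod-trans (mod-reflexive (regroup (y m) (δ m j') _)) (mod-*ˡ (δ m j') (z m))))
                         (mod-reflexive (Σ-0 t _ (λ m → ℤP.*-zeroʳ (δ m j')))))
    where
    regroup : ∀ y d e → y * (d * e) ≡ d * (y * e)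
    regroup = solve-∀

  InKernelB⇒InKernel⁰ : ∀ c → InKernelB c → InKernel⁰ (c ⊙ Q⁻¹)
  InKernelB⇒InKernel⁰ c z = ⊙B⁰≋0⇒InKernel⁰ (c ⊙ Q⁻¹) (λ j → mod-trans (⊙Q⁻¹⊙B⁰ c j) (⊙-0 T' z j))

  InKernel⁰⇒InKernelB : ∀ y → InKernel⁰ y → InKernelB (y ⊙ Q)
  InKernel⁰⇒InKernelB y z j =
    mod-trans (mod-sym (⊙-cancel T' T'⁻¹ (proj₁ invT) (y ⊙ Q ⊙ B) j))
              (⊙-0 T'⁻¹ (λ j' → mod-trans (mod-reflexive (trans (⊙-cong T' (⊙-assoc y Q B) j') (⊙-assoc y (Q · B) T' j')))
                                          (InKernel⁰⇒⊙B⁰≋0 y z j')) j)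

  preservesB⇒preserves : PreservesKernelB → Preserves S'
  preservesB⇒preserves preserves y z =
    InKernel⁰-≋ (λ l → mod-trans (mod-sym (⊙S' (y ⊙ Q) l)) (⊙-modˡ S' (⊙-cancel Q Q⁻¹ (proj₁ invQ) y) l))
                (InKernelB⇒InKernel⁰ (y ⊙ Q ⊙ S) (preserves (y ⊙ Q) (InKernel⁰⇒InKernelB y z)))

  preserves⇒preservesB : Preserves S' → PreservesKernelB
  preserves⇒preservesB preserves c z =
    InKernelB-≋ (⊙-cancel Q⁻¹ Q (proj₂ invQ) (c ⊙ S))
                (InKernel⁰⇒InKernelB (c ⊙ S ⊙ Q⁻¹)
                   (InKernel⁰-≋ (⊙S' c) (preserves (c ⊙ Q⁻¹) (InKernelB⇒InKernel⁰ c z))))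

  preservesB⇔degree : PreservesKernelB ⇔ DegreeCondition S'
  preservesB⇔degree = (preserves⇒degree S' ∘ preservesB⇒preserves) , (preserves⇒preservesB ∘ degree⇒preserves S')

mod-scale⇔ : ∀ {m x} D .{{_ : NonZero D}} → (x ≡ + 0 [mod m ]) ⇔ (+ D * x ≡ + 0 [mod D ℕ.* m ])
mod-scale⇔ {m} {x} (suc d) =
  (λ z → mod-trans (mod-scale (suc d) z) (mod-reflexive (ℤP.*-zeroʳ (+ suc d)))) , mod-cancel d

module ScaledVoltages {n : ℕ} (Γ : Graph n) (T : SpanningTree Γ) (Wk : TreeWalks T) (v0 : Fin n)
                      (t : ℕ) (C : Cotree T t) (p : ℕ) {{p≢0 : NonZero p}} {a : ℕ} (ks : Fin a → ℕ)
                      (k : ℕ) (ks≤k : ∀ j → ks j ≤ k)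
                      (V : Voltage Γ a (λ j → p ^ ks j)) (reduced : TReduced T V) where

  open WalkVoltages Γ T Wk v0 t C V reduced

  B : Mat t a
  B = Bmat Wk C v0 V p k ks

  ⊙B : ∀ c j → (c ⊙ B) j ≡ +^ p (k ∸ ks j) * (c ⊙ Θ) j
  ⊙B c j = trans (Σ-cong t (λ i → regroup (c i) (+^ p (k ∸ ks j)) (Θ i j))) (Σ-*ˡ t (+^ p (k ∸ ks j)) (λ i → c i * Θ i j))
    where
    regroup : ∀ c P v → c * (P * v) ≡ P * (c * v)
    regroup = solve-∀

  p^k≡ : ∀ j → p ^ k ≡ p ^ (k ∸ ks j) ℕ.* p ^ ks j
  p^k≡ j = trans (cong (p ^_) (sym (ℕP.m∸n+n≡m (ks≤k j)))) (ℕP.^-distribˡ-+-* p (k ∸ ks j) (ks j))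

  kernel⇔ : ∀ c → (∀ j → (c ⊙ Θ) j ≡ + 0 [mod p ^ ks j ]) ⇔ (c ⊙ B ≋ 0ᵥ [mod p ^ k ])
  kernel⇔ c = (λ z j → proj₁ (column j) (z j)) , (λ z j → proj₂ (column j) (z j))
    where
    column : ∀ j → ((c ⊙ Θ) j ≡ + 0 [mod p ^ ks j ]) ⇔ ((c ⊙ B) j ≡ + 0 [mod p ^ k ])
    column j = subst (λ e → Z ⇔ (e ≡ + 0 [mod p ^ k ])) (sym (⊙B c j))
                     (subst (λ N → Z ⇔ (P * (c ⊙ Θ) j ≡ + 0 [mod N ])) (sym (p^k≡ j))
                            (mod-scale⇔ (p ^ (k ∸ ks j)) {{ℕP.m^n≢0 p (k ∸ ks j)}}))
      where
      Z = (c ⊙ Θ) j ≡ + 0 [mod p ^ ks j ]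
      P = +^ p (k ∸ ks j)

-- Primality of p enters only through p ≢ 0, and the ordering of the kⱼ only through kⱼ ≤ k.
theorem3p3 : ∀ {n : ℕ} (Γ : Graph n) (T : SpanningTree Γ) (Wk : TreeWalks T) (v0 : Fin n)
    (t : ℕ) (C : Cotree T t)
    (p : ℕ) → Prime p →
    ∀ (a' : ℕ) (ks : Fin (suc a') → ℕ) → (∀ η η' → toℕ η ≤ toℕ η' → ks η ≤ ks η') →
    ∀ (k : ℕ) → k ≡ ks (fromℕ a') →
    ∀ (V : Voltage Γ (suc a') (λ η → p ^ ks η)) → TReduced T V →
    ∀ (Al : Aut Γ) (S : Mat t t) → IsSα Wk C v0 Al S →
    ∀ (Q Q⁻¹ : Mat t t) → InverseMod (p ^ k) Q Q⁻¹ →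
    ∀ (T' T'⁻¹ : Mat (suc a') (suc a')) → InverseMod (p ^ k) T' T'⁻¹ →
    ∀ (s : Fin t → ℕ) → IsNormalForm p k ((Q · Bmat Wk C v0 V p k ks) · T') s →
    Lifts V Al ⇔
      (∀ i j → toℕ j < toℕ i → s i ∸ s j ≤ dp p k (((Q · S) · Q⁻¹) i j))
theorem3p3 Γ T Wk v0 t C p p-prime a' ks ks-mono k refl V reduced Al S isS Q Q⁻¹ invQ T' T'⁻¹ invT s nf =
  proj₁ NF.preservesB⇔degree ∘ toB ∘ LC.lifts⇒preservesKernel ,
  LC.preservesKernel⇒lifts ∘ fromB ∘ proj₂ NF.preservesB⇔degree
  where
  instance
    p≢0 : NonZero p
    p≢0 = prime⇒nonZero p-prime
  ks≤k : ∀ j → ks j ≤ ks (fromℕ a')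
  ks≤k j = ks-mono j (fromℕ a') (subst (toℕ j ≤_) (sym (FP.toℕ-fromℕ a')) (ℕP.≤-pred (FP.toℕ<n j)))
  module SV = ScaledVoltages Γ T Wk v0 t C p ks k ks≤k V reduced
  module LC = LiftingCriterion Γ T Wk v0 t C V reduced (λ j → ℕP.m^n≢0 p (ks j))
                               (p ^ k) {{ℕP.m^n≢0 p k}} (λ j → ^-∣ p (ks j) k (ks≤k j)) Al S isS
  module NF = NormalFormCriterion p k SV.B S Q Q⁻¹ T' T'⁻¹ invQ invT s nf
  toB : LC.PreservesKernel → NF.PreservesKernelB
  toB preserves c z = proj₁ (SV.kernel⇔ (c ⊙ S)) (preserves c (proj₂ (SV.kernel⇔ c) z))
  fromB : NF.PreservesKernelB → LC.PreservesKernel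
  fromB preserves c z = proj₂ (SV.kernel⇔ (c ⊙ S)) (preserves c (proj₁ (SV.kernel⇔ c) z))
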